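{- Let $G$ be a finite abelian group of order $n$ and exponent $q$ that is not isomorphic to an elementary abelian $2$-group, and let $l$ be the order of its subgroup of elements of order at most $2$. For every integer $h$ with $(n+l)/2-1\le h\le n-2$ we have $Z_h(G)=h$ if either $h=n-3$ and $q=3$, or $h=n-2$, $l=2$, and $q\equiv 2\pmod 4$; and $Z_h(G)=h+1$ otherwise.
   Context: $G$ is written additively. For $A\subseteq G$ and a positive integer $h$, $h\hat{\;}A$ denotes the set of all sums of $h$ pairwise distinct elements of $A$. $Z_h(G)=\max\{|A| : A\subseteq G,\ 0\notin h\hat{\;}A\}$. -}

module Defs where

open import Level using (Level; _⊔_)
open import Algebra.Bundles using (AbelianGroup)
open import Data.Nat using (ℕ; zero; suc; _≤_; _+_; _*_; _∸_)
open import Data.Fin using (Fin; zero; suc)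
open import Data.Fin.Subset using (Subset; inside; outside; _⊆_; ∣_∣; _∈_)
open import Data.Vec using ([]; _∷_)
open import Data.Product using (Σ; ∃; _×_; _,_)
open import Relation.Binary.PropositionalEquality using (_≡_)
open import Relation.Nullary using (¬_)
open import Function using (_∘_; _⇔_)

record FiniteAbelianGroup (c ℓ : Level) : Set (Level.suc (c ⊔ ℓ)) where
  field
    abGroup  : AbelianGroup c ℓ
  open AbelianGroup abGroup public
  field
    order    : ℕ
    enum     : Fin order → Carrier
    enum-inj : ∀ i j → enum i ≈ enum j → i ≡ j
    enum-sur : ∀ x → ∃ λ i → enum i ≈ x

module _ {c ℓ : Level} (G : FiniteAbelianGroup c ℓ) where
  open FiniteAbelianGroup G

  _·_ : ℕ → Carrier → Carrier
  zero  · x = ε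
  suc k · x = x ∙ (k · x)

  sumSub : ∀ {m} → (Fin m → Carrier) → Subset m → Carrier
  sumSub f []            = ε
  sumSub f (inside ∷ p)  = f zero ∙ sumSub (f ∘ suc) p
  sumSub f (outside ∷ p) = sumSub (f ∘ suc) p

  -- subsets A ⊆ G are represented as subsets of Fin order (via enum).
  -- 0 ∈ h^A : some h pairwise distinct elements of A sum to 0.
  ZeroInRestrictedSumset : ℕ → Subset order → Set ℓ
  ZeroInRestrictedSumset h A =
    Σ (Subset order) λ B → (B ⊆ A) × (∣ B ∣ ≡ h) × (sumSub enum B ≈ ε)

  IsZ : ℕ → ℕ → Set ℓ
  IsZ h m =
    (Σ (Subset order) λ A → (∣ A ∣ ≡ m) × ¬ ZeroInRestrictedSumset h A)
    × (∀ A → ¬ ZeroInRestrictedSumset h A → ∣ A ∣ ≤ m)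

  IsExponent : ℕ → Set (c ⊔ ℓ)
  IsExponent q =
    (1 ≤ q) × (∀ x → q · x ≈ ε)
    × (∀ k → 1 ≤ k → (∀ x → k · x ≈ ε) → q ≤ k)

  IsOrderOfTwoTorsion : ℕ → Set ℓ
  IsOrderOfTwoTorsion l =
    Σ (Subset order) λ S → (∀ i → (i ∈ S) ⇔ (enum i ∙ enum i ≈ ε)) × (∣ S ∣ ≡ l)

  IsElementary2Group : Set (c ⊔ ℓ)
  IsElementary2Group = ∀ x → x ∙ x ≈ ε

module Submission where

-- Let s be the sum of all elements of G, T its subgroup of elements of order at most 2 (so
-- |T| = l) and P = G ∖ T.  Pairing x with −x on P shows s = ΣT, and translating T by any
-- u ∈ T ∖ {0} shows ΣT = 0 unless l = 2, in which case s is the unique involution j.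
--
-- Upper bound: for |A| = h + 2 the map x ↦ ΣA − x has at most l fixed points, and it sends every
-- other element of A outside A unless two distinct elements of A sum to ΣA; the former would give
-- 2|A| ≤ n + l ≤ 2(h + 1).  Dropping such a pair leaves h elements with sum 0.
--
-- Lower bound: if |A| = h + 1 then 0 ∈ h^A iff ΣA ∈ A.  With C the complement of A
-- (|C| = m = n − h − 1) it suffices that some c ∈ C has c + ΣC = s, for then ΣA = c ∉ A.  Such a
-- C is a small core padded with pairs {x, −x} from P, of which there are enough as 2m ≤ n − l:
-- {0}, {c, −2c} (3c ≠ 0) or {0, a, b, a + b} (3G = 0) when s = 0, and {0, j}, {c} (2c = j) or
-- {0, x, j − x} (2x ≠ j) when s = j.  A suitable core is missing only in the two exceptional
-- cases, and there every (h + 1)-set contains its own sum, so Z_h(G) = h.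

open import Defs hiding (_·_; sumSub)
import Defs
open import Level using (Level; _⊔_)
open import Data.Nat using (ℕ; zero; suc; _≟_; _≤_; _<_; _+_; _*_; _%_; _/_; ⌊_/2⌋; z≤n; s≤s; NonZero)
open import Data.Nat.DivMod using (m≡m%n+[m/n]*n; m%n<n)
open import Data.Nat.Tactic.RingSolver using (solve-∀)
open import Data.Nat.Properties
  using (≤-refl; ≤-trans; n≤1+n; +-suc; suc-injective; m+[n∸m]≡n; <-irrefl; ≤-pred; +-monoʳ-≤; n≡⌊n+n/2⌋;
         _≤?_; ≰⇒>; <⇒≱; +-comm; m≤n⇒∃[o]m+o≡n; m≤n+m; +-cancelʳ-≤; +-cancelˡ-<; +-identityʳ;
         +-cancelˡ-≡; +-cancelˡ-≤; +-mono-≤; m≤m+n; m<m+n; module ≤-Reasoning)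
open import Data.Fin as Fin using (Fin; zero; suc)
open import Data.Fin.Properties using (any?) renaming (suc-injective to fsuc-injective)
open import Data.Fin.Subset
  using (Subset; inside; outside; _⊆_; ∣_∣; _∈_; _∉_; ∁; ⊤; ⊥; Nonempty)
open import Data.Fin.Subset.Properties
  using (_∈?_; drop-∷-⊆; s⊆s; ⊆-min; ∣⊥∣≡0; ∉⊥; ∣⊤∣≡n; p⊆q⇒∣p∣≤∣q∣; ∣p∣≤n; ∣∁p∣≡n∸∣p∣;
         x∈∁p⇒x∉p; x∉p⇒x∈∁p)
open import Data.Vec using ([]; _∷_; here; there)
open import Data.List using (List; []; _∷_; length; foldr)
open import Data.List.Relation.Unary.Unique.Propositional using (Unique)
open import Data.List.Relation.Unary.All as All using (All; []; _∷_)
open import Data.List.Relation.Unary.AllPairs using ([]; _∷_)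
open import Data.Product using (Σ; ∃; _×_; _,_; proj₁; proj₂)
open import Data.Sum using (_⊎_; inj₁; inj₂)
open import Data.Empty using (⊥-elim)
open import Function using (_∘_; id; _⇔_; Equivalence)
open import Relation.Binary.PropositionalEquality
  using (_≡_; _≢_; refl; sym; trans; cong; cong₂; subst; subst₂)
open import Relation.Nullary using (¬_; Dec; yes; no; ¬?; _×-dec_)
open import Relation.Nullary.Decidable using (decidable-stable)
open import Relation.Unary using (Pred; Decidable)

private
  variable
    ℓ₀ : Level
    n : ℕ
    i i′ : Fin n
    p q : Subset n

2[2k+d]≤p≤2d+r⇒2k≤r : ∀ k d {p r} → (k + k + d) + (k + k + d) ≤ p → p ≤ (d + d) + r → k + k ≤ r
2[2k+d]≤p≤2d+r⇒2k≤r k d {p} {r} 2[2k+d]≤p p≤2d+r = +-cancelˡ-≤ (d + d) _ _ (begin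
  (d + d) + (k + k)               ≤⟨ +-monoʳ-≤ (d + d) (m≤m+n (k + k) (k + k)) ⟩
  (d + d) + ((k + k) + (k + k))   ≡⟨ regroup k d ⟩
  (k + k + d) + (k + k + d)       ≤⟨ 2[2k+d]≤p ⟩
  p                               ≤⟨ p≤2d+r ⟩
  (d + d) + r                     ∎)
  where
  open ≤-Reasoning
  regroup : ∀ k d → (d + d) + ((k + k) + (k + k)) ≡ (k + k + d) + (k + k + d)
  regroup = solve-∀

a≤t+c⇒a+a≤[a+c]+t : ∀ {a t c} → a ≤ t + c → a + a ≤ (a + c) + t
a≤t+c⇒a+a≤[a+c]+t {a} {t} {c} a≤t+c = subst (a + a ≤_) (regroup a t c) (+-monoʳ-≤ a a≤t+c)
  where
  regroup : ∀ a t c → a + (t + c) ≡ (a + c) + t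
  regroup = solve-∀

m≤2[h+1]⇒m<[2+h]+[2+h] : ∀ {m h} → m ≤ 2 * (h + 1) → m < (2 + h) + (2 + h)
m≤2[h+1]⇒m<[2+h]+[2+h] {m} {h} m≤2[h+1] = subst (m <_) (regroup h) (s≤s (≤-trans m≤2[h+1] (n≤1+n _)))
  where
  regroup : ∀ h → suc (suc (2 * (h + 1))) ≡ (2 + h) + (2 + h)
  regroup = solve-∀

[r+r]+[r+r]≡r*4 : ∀ r → (r + r) + (r + r) ≡ r * 4
[r+r]+[r+r]≡r*4 = solve-∀

m<n∧m+k≡n⇒0<k : ∀ {m n k} → m < n → m + k ≡ n → 0 < k
m<n∧m+k≡n⇒0<k {m} {n} {k} m<n m+k≡n = +-cancelˡ-< m 0 k (subst₂ _<_ (sym (+-identityʳ m)) (sym m+k≡n) m<n)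

shift : ∀ k d → suc k + suc k + d ≡ k + k + (2 + d)
shift = solve-∀

parity⁺ : ∀ m → 0 < m → ∃ λ k → m ≡ k + k + 1 ⊎ m ≡ k + k + 2
parity⁺ 1                   _ = 0 , inj₁ refl
parity⁺ 2                   _ = 0 , inj₂ refl
parity⁺ (suc (suc (suc m))) _ with parity⁺ (suc m) (s≤s z≤n)
... | k , inj₁ m≡2k+1 = suc k , inj₁ (trans (cong (2 +_) m≡2k+1) (cong (λ t → suc (t + 1)) (sym (+-suc k k))))
... | k , inj₂ m≡2k+2 = suc k , inj₂ (trans (cong (2 +_) m≡2k+2) (cong (λ t → suc (t + 2)) (sym (+-suc k k))))

m+1+h≡n⇒0<m : ∀ {m h n} → m + suc h ≡ n → h + 2 ≤ n → 0 < m
m+1+h≡n⇒0<m {zero}  {h} 1+h≡n h+2≤n = ⊥-elim (<-irrefl refl (subst₂ _≤_ (+-comm h 2) (sym 1+h≡n) h+2≤n))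
m+1+h≡n⇒0<m {suc m}     _     _     = s≤s z≤n

n+l≤2[h+1]⇒0<h : ∀ {h n l} → n + l ≤ 2 * (h + 1) → 0 < l → h + 2 ≤ n → 0 < h
n+l≤2[h+1]⇒0<h {zero}  n+l≤2 0<l 2≤n with ≤-trans (+-mono-≤ 2≤n 0<l) n+l≤2
... | s≤s (s≤s ())
n+l≤2[h+1]⇒0<h {suc h} _     _   _   = s≤s z≤n

m+1+h≡n⇒m+m≤p : ∀ {m h n l p} → m + suc h ≡ n → n + l ≤ 2 * (h + 1) → l + p ≡ n → m + m ≤ p
m+1+h≡n⇒m+m≤p {m} {h} {n} {l} {p} m+1+h≡n n+l≤2[h+1] l+p≡n = +-cancelʳ-≤ (n + l) (m + m) p (begin
  (m + m) + (n + l)            ≤⟨ +-monoʳ-≤ (m + m) n+l≤2[h+1] ⟩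
  (m + m) + 2 * (h + 1)        ≡⟨ regroup₁ m h ⟩
  (m + suc h) + (m + suc h)    ≡⟨ cong₂ _+_ m+1+h≡n m+1+h≡n ⟩
  n + n                        ≡⟨ cong (n +_) l+p≡n ⟨
  n + (l + p)                  ≡⟨ regroup₂ n l p ⟩
  p + (n + l)                  ∎)
  where
  open ≤-Reasoning
  regroup₁ : ∀ m h → (m + m) + 2 * (h + 1) ≡ (m + suc h) + (m + suc h)
  regroup₁ = solve-∀
  regroup₂ : ∀ n l p → n + (l + p) ≡ p + (n + l)
  regroup₂ = solve-∀

remove : Fin n → Subset n → Subset n
remove zero    (_ ∷ p) = outside ∷ p
remove (suc i) (x ∷ p) = x ∷ remove i p

insert : Fin n → Subset n → Subset n
insert zero    (_ ∷ p) = inside ∷ p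
insert (suc i) (x ∷ p) = x ∷ insert i p

∣remove∣ : i ∈ p → ∣ p ∣ ≡ suc ∣ remove i p ∣
∣remove∣ {i = zero}  {inside ∷ p}  here      = refl
∣remove∣ {i = suc i} {inside ∷ p}  (there h) = cong suc (∣remove∣ h)
∣remove∣ {i = suc i} {outside ∷ p} (there h) = ∣remove∣ h

∣remove∣-≤ : ∀ i (p : Subset n) → ∣ p ∣ ≤ suc ∣ remove i p ∣
∣remove∣-≤ zero    (inside ∷ p)  = ≤-refl
∣remove∣-≤ zero    (outside ∷ p) = n≤1+n _
∣remove∣-≤ (suc i) (inside ∷ p)  = s≤s (∣remove∣-≤ i p)
∣remove∣-≤ (suc i) (outside ∷ p) = ∣remove∣-≤ i p

∣insert∣ : i ∉ p → ∣ insert i p ∣ ≡ suc ∣ p ∣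
∣insert∣ {i = zero}  {inside ∷ p}  i∉p = ⊥-elim (i∉p here)
∣insert∣ {i = zero}  {outside ∷ p} i∉p = refl
∣insert∣ {i = suc i} {inside ∷ p}  i∉p = cong suc (∣insert∣ (i∉p ∘ there))
∣insert∣ {i = suc i} {outside ∷ p} i∉p = ∣insert∣ (i∉p ∘ there)

∈-remove⁻ : i′ ∈ remove i p → i′ ∈ p × i′ ≢ i
∈-remove⁻ {i′ = zero}  {zero}  {x ∷ p} ()
∈-remove⁻ {i′ = suc j} {zero}  {x ∷ p} (there h) = there h , λ ()
∈-remove⁻ {i′ = zero}  {suc i} {x ∷ p} here      = here , λ ()
∈-remove⁻ {i′ = suc j} {suc i} {x ∷ p} (there h) =
  let j∈p , j≢i = ∈-remove⁻ h in there j∈p , j≢i ∘ fsuc-injective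

∈-remove⁺ : i′ ∈ p → i′ ≢ i → i′ ∈ remove i p
∈-remove⁺ {i′ = zero}  {x ∷ p} {zero}  h         j≢i = ⊥-elim (j≢i refl)
∈-remove⁺ {i′ = suc j} {x ∷ p} {zero}  (there h) j≢i = there h
∈-remove⁺ {i′ = zero}  {x ∷ p} {suc i} here      j≢i = here
∈-remove⁺ {i′ = suc j} {x ∷ p} {suc i} (there h) j≢i = there (∈-remove⁺ h (j≢i ∘ cong suc))

x∈insert : ∀ i (p : Subset n) → i ∈ insert i p
x∈insert zero    (x ∷ p) = here
x∈insert (suc i) (x ∷ p) = there (x∈insert i p)

∈-insert⁺ : i′ ∈ p → i′ ∈ insert i p
∈-insert⁺ {i′ = zero}  {x ∷ p} {zero}  here      = here
∈-insert⁺ {i′ = suc j} {x ∷ p} {zero}  (there h) = there h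
∈-insert⁺ {i′ = zero}  {x ∷ p} {suc i} here      = here
∈-insert⁺ {i′ = suc j} {x ∷ p} {suc i} (there h) = there (∈-insert⁺ h)

∈-insert⁻ : i′ ∈ insert i p → i′ ≡ i ⊎ i′ ∈ p
∈-insert⁻ {i′ = zero}  {zero}  {x ∷ p} h         = inj₁ refl
∈-insert⁻ {i′ = suc j} {zero}  {x ∷ p} (there h) = inj₂ (there h)
∈-insert⁻ {i′ = zero}  {suc i} {x ∷ p} here      = inj₂ here
∈-insert⁻ {i′ = suc j} {suc i} {x ∷ p} (there h) with ∈-insert⁻ h
... | inj₁ j≡i = inj₁ (cong suc j≡i)
... | inj₂ j∈p = inj₂ (there j∈p)

∉-insert : i′ ≢ i → i′ ∉ p → i′ ∉ insert i p
∉-insert j≢i j∉p h with ∈-insert⁻ h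
... | inj₁ j≡i = j≢i j≡i
... | inj₂ j∈p = j∉p j∈p

remove-insert : i ∉ p → remove i (insert i p) ≡ p
remove-insert {i = zero}  {inside ∷ p}  i∉p = ⊥-elim (i∉p here)
remove-insert {i = zero}  {outside ∷ p} i∉p = refl
remove-insert {i = suc i} {x ∷ p}       i∉p = cong (x ∷_) (remove-insert (i∉p ∘ there))

∣p∣>0⇒nonempty : ∀ (p : Subset n) → 0 < ∣ p ∣ → Nonempty p
∣p∣>0⇒nonempty (inside ∷ p)  _ = zero , here
∣p∣>0⇒nonempty (outside ∷ p) h = let i , i∈p = ∣p∣>0⇒nonempty p h in suc i , there i∈p

∣p∣≡0⇒∉ : ∣ p ∣ ≡ 0 → i ∉ p
∣p∣≡0⇒∉ {p = outside ∷ p} ∣p∣≡0 (there h) = ∣p∣≡0⇒∉ ∣p∣≡0 h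

∣p∣+∣∁p∣≡n : ∀ (p : Subset n) → ∣ p ∣ + ∣ ∁ p ∣ ≡ n
∣p∣+∣∁p∣≡n p = trans (cong (∣ p ∣ +_) (∣∁p∣≡n∸∣p∣ p)) (m+[n∸m]≡n (∣p∣≤n p))

⊆-ofSize : ∀ k (p : Subset n) → k ≤ ∣ p ∣ → ∃ λ q → q ⊆ p × ∣ q ∣ ≡ k
⊆-ofSize {n} zero p _ = ⊥ , ⊆-min p , ∣⊥∣≡0 n
⊆-ofSize (suc k) (inside ∷ p)  k≤p =
  let q , q⊆p , ∣q∣ = ⊆-ofSize k p (≤-pred k≤p) in inside ∷ q , s⊆s q⊆p , cong suc ∣q∣
⊆-ofSize (suc k) (outside ∷ p) k≤p =
  let q , q⊆p , ∣q∣ = ⊆-ofSize (suc k) p k≤p in outside ∷ q , s⊆s q⊆p , ∣q∣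

⊆∧∣∣≡⇒≡ : q ⊆ p → ∣ q ∣ ≡ ∣ p ∣ → q ≡ p
⊆∧∣∣≡⇒≡ {q = []}          {[]}          _   _ = refl
⊆∧∣∣≡⇒≡ {q = inside ∷ q}  {inside ∷ p}  q⊆p e =
  cong (inside ∷_) (⊆∧∣∣≡⇒≡ (drop-∷-⊆ q⊆p) (suc-injective e))
⊆∧∣∣≡⇒≡ {q = outside ∷ q} {outside ∷ p} q⊆p e = cong (outside ∷_) (⊆∧∣∣≡⇒≡ (drop-∷-⊆ q⊆p) e)
⊆∧∣∣≡⇒≡ {q = inside ∷ q}  {outside ∷ p} q⊆p e with q⊆p here
... | ()
⊆∧∣∣≡⇒≡ {q = outside ∷ q} {inside ∷ p}  q⊆p e =
  ⊥-elim (<-irrefl e (s≤s (p⊆q⇒∣p∣≤∣q∣ (drop-∷-⊆ q⊆p))))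

⊆∧1+∣∣≡⇒≡remove : q ⊆ p → suc ∣ q ∣ ≡ ∣ p ∣ → ∃ λ i → i ∈ p × q ≡ remove i p
⊆∧1+∣∣≡⇒≡remove {q = []} {[]} _ ()
⊆∧1+∣∣≡⇒≡remove {q = inside ∷ q} {inside ∷ p} q⊆p e =
  let i , i∈p , q≡ = ⊆∧1+∣∣≡⇒≡remove (drop-∷-⊆ q⊆p) (suc-injective e)
  in suc i , there i∈p , cong (inside ∷_) q≡
⊆∧1+∣∣≡⇒≡remove {q = outside ∷ q} {outside ∷ p} q⊆p e =
  let i , i∈p , q≡ = ⊆∧1+∣∣≡⇒≡remove (drop-∷-⊆ q⊆p) e
  in suc i , there i∈p , cong (outside ∷_) q≡
⊆∧1+∣∣≡⇒≡remove {q = inside ∷ q} {outside ∷ p} q⊆p e with q⊆p here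
... | ()
⊆∧1+∣∣≡⇒≡remove {q = outside ∷ q} {inside ∷ p} q⊆p e =
  zero , here , cong (outside ∷_) (⊆∧∣∣≡⇒≡ (drop-∷-⊆ q⊆p) (suc-injective e))

filter : {P : Pred (Fin n) ℓ₀} → Decidable P → Subset n → Subset n
filter P? [] = []
filter P? (x ∷ p) with P? zero
... | yes _ = x ∷ filter (P? ∘ suc) p
... | no _  = outside ∷ filter (P? ∘ suc) p

∈-filter⁻ : {P : Pred (Fin n) ℓ₀} (P? : Decidable P) → i ∈ filter P? p → i ∈ p × P i
∈-filter⁻ {i = zero} {x ∷ p} P? h with P? zero
∈-filter⁻ {i = zero} {x ∷ p} P? here | yes Pi = here , Pi
∈-filter⁻ {i = suc i} {x ∷ p} P? h with P? zero
∈-filter⁻ {i = suc i} {x ∷ p} P? (there h) | yes _ = let i∈p , Pi = ∈-filter⁻ (P? ∘ suc) h in there i∈p , Pi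
∈-filter⁻ {i = suc i} {x ∷ p} P? (there h) | no _  = let i∈p , Pi = ∈-filter⁻ (P? ∘ suc) h in there i∈p , Pi

∣filter∣+∣filter¬∣ : {P : Pred (Fin n) ℓ₀} (P? : Decidable P) (p : Subset n) →
  ∣ filter P? p ∣ + ∣ filter (¬? ∘ P?) p ∣ ≡ ∣ p ∣
∣filter∣+∣filter¬∣ P? [] = refl
∣filter∣+∣filter¬∣ P? (x ∷ p) with P? zero
∣filter∣+∣filter¬∣ P? (inside ∷ p)  | yes _ = cong suc (∣filter∣+∣filter¬∣ (P? ∘ suc) p)
∣filter∣+∣filter¬∣ P? (outside ∷ p) | yes _ = ∣filter∣+∣filter¬∣ (P? ∘ suc) p
∣filter∣+∣filter¬∣ P? (inside ∷ p)  | no _  = trans (+-suc _ _) (cong suc (∣filter∣+∣filter¬∣ (P? ∘ suc) p))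
∣filter∣+∣filter¬∣ P? (outside ∷ p) | no _  = ∣filter∣+∣filter¬∣ (P? ∘ suc) p

∃-∈-avoiding : ∀ (p : Subset n) xs → length xs < ∣ p ∣ → ∃ λ i → i ∈ p × All (i ≢_) xs
∃-∈-avoiding p []       0<∣p∣ = let i , i∈p = ∣p∣>0⇒nonempty p 0<∣p∣ in i , i∈p , []
∃-∈-avoiding p (x ∷ xs) 1+∣xs∣<∣p∣ =
  let i , i∈p-x , i≢xs = ∃-∈-avoiding (remove x p) xs (≤-pred (≤-trans 1+∣xs∣<∣p∣ (∣remove∣-≤ x p)))
      i∈p , i≢x = ∈-remove⁻ i∈p-x
  in i , i∈p , i≢x ∷ i≢xs

fromList : List (Fin n) → Subset n
fromList = foldr insert ⊥

∉-fromList : ∀ {xs} → All (i ≢_) xs → i ∉ fromList {n} xs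
∉-fromList []           = ∉⊥
∉-fromList (i≢x ∷ i≢xs) = ∉-insert i≢x (∉-fromList i≢xs)

∣fromList∣ : ∀ {xs} → Unique xs → ∣ fromList {n} xs ∣ ≡ length xs
∣fromList∣ {n} {[]}     []              = ∣⊥∣≡0 n
∣fromList∣ {xs = _ ∷ _} (x≢xs ∷ unique) = trans (∣insert∣ (∉-fromList x≢xs)) (cong suc (∣fromList∣ unique))

injection⇒∣p∣≤∣q∣ : (g : Fin n → Fin n) → (∀ {i} → i ∈ p → g i ∈ q) →
  (∀ {i j} → i ∈ p → j ∈ p → g i ≡ g j → i ≡ j) → ∣ p ∣ ≤ ∣ q ∣
injection⇒∣p∣≤∣q∣ {p = p} g = go ∣ p ∣ refl
  where
  go : ∀ k {p q} → ∣ p ∣ ≡ k → (∀ {i} → i ∈ p → g i ∈ q) →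
       (∀ {i j} → i ∈ p → j ∈ p → g i ≡ g j → i ≡ j) → ∣ p ∣ ≤ ∣ q ∣
  go zero    ∣p∣≡0 _ _ rewrite ∣p∣≡0 = z≤n
  go (suc k) {p} {q} ∣p∣≡1+k maps inj
    with i , i∈p ← ∣p∣>0⇒nonempty p (subst (0 <_) (sym ∣p∣≡1+k) (s≤s z≤n)) =
    subst₂ _≤_ (sym (∣remove∣ i∈p)) (sym (∣remove∣ (maps i∈p)))
      (s≤s (go k (suc-injective (trans (sym (∣remove∣ i∈p)) ∣p∣≡1+k)) maps′ inj′))
    where
    maps′ : ∀ {j} → j ∈ remove i p → g j ∈ remove (g i) q
    maps′ h = let j∈p , j≢i = ∈-remove⁻ h in ∈-remove⁺ (maps j∈p) (j≢i ∘ inj j∈p i∈p)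
    inj′ : ∀ {j j′} → j ∈ remove i p → j′ ∈ remove i p → g j ≡ g j′ → j ≡ j′
    inj′ h h′ = inj (proj₁ (∈-remove⁻ h)) (proj₁ (∈-remove⁻ h′))

module _ {c ℓ : Level} (G : FiniteAbelianGroup c ℓ) where
  open FiniteAbelianGroup G renaming (refl to ≈-refl; sym to ≈-sym; trans to ≈-trans)
  open import Algebra.Properties.AbelianGroup abGroup
  open import Algebra.Properties.CommutativeSemigroup commutativeSemigroup
    using (interchange; x∙yz≈y∙xz)
  open import Algebra.Properties.CommutativeMonoid.Mult commutativeMonoid
    using (×-homo-+; ×-assocˡ; ×-congʳ; ×-distrib-+) renaming (_×_ to _·_)
  open import Relation.Binary.Reasoning.Setoid setoid

  ·≡Defs· : ∀ k x → Defs._·_ G k x ≡ k · x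
  ·≡Defs· zero    x = refl
  ·≡Defs· (suc k) x = cong (x ∙_) (·≡Defs· k x)

  ·-ε : ∀ k → k · ε ≈ ε
  ·-ε zero    = ≈-refl
  ·-ε (suc k) = ≈-trans (identityˡ _) (·-ε k)

  ·-mod : ∀ k n .{{_ : NonZero n}} x → n · x ≈ ε → k · x ≈ (k % n) · x
  ·-mod k n x n·x≈ε = begin
    k · x                               ≡⟨ cong (_· x) (m≡m%n+[m/n]*n k n) ⟩
    (k % n + k / n * n) · x             ≈⟨ ×-homo-+ x (k % n) _ ⟩
    (k % n) · x ∙ (k / n * n) · x       ≈⟨ ∙-congˡ (≈-sym (×-assocˡ x (k / n) n)) ⟩
    (k % n) · x ∙ (k / n) · (n · x)     ≈⟨ ∙-congˡ (≈-trans (×-congʳ (k / n) n·x≈ε) (·-ε (k / n))) ⟩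
    (k % n) · x ∙ ε                     ≈⟨ identityʳ _ ⟩
    (k % n) · x                         ∎

  e : Fin order → Carrier
  e = enum

  index : Carrier → Fin order
  index x = proj₁ (enum-sur x)

  e-index : ∀ x → e (index x) ≈ x
  e-index x = proj₂ (enum-sur x)

  e-injective : e i ≈ e i′ → i ≡ i′
  e-injective = enum-inj _ _

  index-unique : ∀ {x} → e i ≈ x → i ≡ index x
  index-unique i≈x = e-injective (≈-trans i≈x (≈-sym (e-index _)))

  index-≡⇒≈ : ∀ {x} → index x ≡ i → x ≈ e i
  index-≡⇒≈ index≡i = ≈-trans (≈-sym (e-index _)) (reflexive (cong e index≡i))

  εᵢ : Fin order
  εᵢ = index ε

  e-εᵢ : e εᵢ ≈ ε
  e-εᵢ = e-index ε

  ≢εᵢ⇒≉ε : i ≢ εᵢ → ¬ e i ≈ ε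
  ≢εᵢ⇒≉ε i≢εᵢ = i≢εᵢ ∘ index-unique

  infix 4 _≈?_
  _≈?_ : ∀ x y → Dec (x ≈ y)
  x ≈? y with index x Fin.≟ index y
  ... | yes eq = yes (begin x ≈⟨ e-index x ⟨ e (index x) ≡⟨ cong e eq ⟩ e (index y) ≈⟨ e-index y ⟩ y ∎)
  ... | no neq = no λ x≈y → neq (index-unique (≈-trans (e-index x) x≈y))

  neg : Fin order → Fin order
  neg i = index (e i ⁻¹)

  e-neg : ∀ i → e (neg i) ≈ e i ⁻¹
  e-neg i = e-index _

  neg-involutive : ∀ i → neg (neg i) ≡ i
  neg-involutive i = sym (index-unique (begin
    e i             ≈⟨ ⁻¹-involutive (e i) ⟨
    e i ⁻¹ ⁻¹       ≈⟨ ⁻¹-cong (e-neg i) ⟨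
    e (neg i) ⁻¹    ∎))

  square-∙ : ∀ {x y} → x ∙ x ≈ ε → y ∙ y ≈ ε → (x ∙ y) ∙ (x ∙ y) ≈ ε
  square-∙ {x} {y} x²≈ε y²≈ε = begin
    (x ∙ y) ∙ (x ∙ y)     ≈⟨ interchange x y x y ⟩
    (x ∙ x) ∙ (y ∙ y)     ≈⟨ ∙-cong x²≈ε y²≈ε ⟩
    ε ∙ ε                 ≈⟨ identityˡ ε ⟩
    ε                     ∎

  square-quotient : ∀ {x y t} → x ∙ x ≈ t → y ∙ y ≈ t → (x ∙ y ⁻¹) ∙ (x ∙ y ⁻¹) ≈ ε
  square-quotient {x} {y} {t} x²≈t y²≈t = begin
    (x ∙ y ⁻¹) ∙ (x ∙ y ⁻¹)     ≈⟨ interchange x (y ⁻¹) x (y ⁻¹) ⟩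
    (x ∙ x) ∙ (y ⁻¹ ∙ y ⁻¹)     ≈⟨ ∙-congˡ (⁻¹-∙-comm y y) ⟩
    (x ∙ x) ∙ (y ∙ y) ⁻¹        ≈⟨ ∙-cong x²≈t (⁻¹-cong y²≈t) ⟩
    t ∙ t ⁻¹                    ≈⟨ inverseʳ t ⟩
    ε                           ∎

  2·x≈x∙x : ∀ x → 2 · x ≈ x ∙ x
  2·x≈x∙x x = ∙-congˡ (identityʳ x)

  3·x≈x∙xx : ∀ x → 3 · x ≈ x ∙ (x ∙ x)
  3·x≈x∙xx x = ∙-congˡ (∙-congˡ (identityʳ x))

  4·x≈ε : ∀ {x y} → x ∙ x ≈ y → y ∙ y ≈ ε → 4 · x ≈ ε
  4·x≈ε {x} {y} x²≈y y²≈ε = begin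
    4 · x             ≈⟨ ×-homo-+ x 2 2 ⟩
    2 · x ∙ 2 · x     ≈⟨ ∙-cong (≈-trans (2·x≈x∙x x) x²≈y) (≈-trans (2·x≈x∙x x) x²≈y) ⟩
    y ∙ y             ≈⟨ y²≈ε ⟩
    ε                 ∎

  sumSub : (Fin n → Carrier) → Subset n → Carrier
  sumSub = Defs.sumSub G

  sumSub-remove : ∀ (f : Fin n → Carrier) → i ∈ p → sumSub f p ≈ f i ∙ sumSub f (remove i p)
  sumSub-remove {i = zero}  {inside ∷ p}  f here      = ≈-refl
  sumSub-remove {i = suc i} {inside ∷ p}  f (there h) =
    ≈-trans (∙-congˡ (sumSub-remove (f ∘ suc) h)) (x∙yz≈y∙xz _ _ _)
  sumSub-remove {i = suc i} {outside ∷ p} f (there h) = sumSub-remove (f ∘ suc) h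

  sumSub-insert : ∀ (f : Fin n → Carrier) → i ∉ p → sumSub f (insert i p) ≈ f i ∙ sumSub f p
  sumSub-insert {i = i} {p} f i∉p = begin
    sumSub f (insert i p)                     ≈⟨ sumSub-remove f (x∈insert i p) ⟩
    f i ∙ sumSub f (remove i (insert i p))    ≡⟨ cong (λ r → f i ∙ sumSub f r) (remove-insert i∉p) ⟩
    f i ∙ sumSub f p                          ∎

  sumSub-∣∣≡0 : ∀ (f : Fin n → Carrier) p → ∣ p ∣ ≡ 0 → sumSub f p ≈ ε
  sumSub-∣∣≡0 f []            _     = ≈-refl
  sumSub-∣∣≡0 f (outside ∷ p) ∣p∣≡0 = sumSub-∣∣≡0 (f ∘ suc) p ∣p∣≡0

  sumSub-⊤ : ∀ (f : Fin n → Carrier) (p : Subset n) → sumSub f ⊤ ≈ sumSub f p ∙ sumSub f (∁ p)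
  sumSub-⊤ f []            = ≈-sym (identityˡ ε)
  sumSub-⊤ f (inside ∷ p)  = ≈-trans (∙-congˡ (sumSub-⊤ (f ∘ suc) p)) (≈-sym (assoc _ _ _))
  sumSub-⊤ f (outside ∷ p) = ≈-trans (∙-congˡ (sumSub-⊤ (f ∘ suc) p)) (x∙yz≈y∙xz _ _ _)

  sum : Subset order → Carrier
  sum = sumSub e

  sumG : Carrier
  sumG = sum ⊤

  sum-∣∣≡1 : i ∈ p → ∣ p ∣ ≡ 1 → sum p ≈ e i
  sum-∣∣≡1 {i = i} {p} i∈p ∣p∣≡1 = begin
    sum p                   ≈⟨ sumSub-remove e i∈p ⟩
    e i ∙ sum (remove i p)  ≈⟨ ∙-congˡ (sumSub-∣∣≡0 e (remove i p) ∣p-i∣≡0) ⟩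
    e i ∙ ε                 ≈⟨ identityʳ _ ⟩
    e i                     ∎
    where
    ∣p-i∣≡0 : ∣ remove i p ∣ ≡ 0
    ∣p-i∣≡0 = suc-injective (trans (sym (∣remove∣ i∈p)) ∣p∣≡1)

  record PairedBy (ι : Fin order → Fin order) (R : Subset order) : Set where
    field
      involutive    : ∀ i → ι (ι i) ≡ i
      closed        : ∀ {i} → i ∈ R → ι i ∈ R
      fixpoint-free : ∀ {i} → i ∈ R → ι i ≢ i

  removePair : (Fin order → Fin order) → Fin order → Subset order → Subset order
  removePair ι i R = remove (ι i) (remove i R)

  ∈-removePair⁻ : ∀ ι {i j R} → j ∈ removePair ι i R → j ∈ R × j ≢ i × j ≢ ι i
  ∈-removePair⁻ ι h = let h′ , j≢ιi = ∈-remove⁻ h ; j∈R , j≢i = ∈-remove⁻ h′ in j∈R , j≢i , j≢ιi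

  ∣removePair∣-≤ : ∀ ι i R → ∣ R ∣ ≤ 2 + ∣ removePair ι i R ∣
  ∣removePair∣-≤ ι i R = ≤-trans (∣remove∣-≤ i R) (s≤s (∣remove∣-≤ (ι i) (remove i R)))

  module _ {ι : Fin order → Fin order} {R : Subset order} (π : PairedBy ι R) where
    open PairedBy π

    ι∈remove : i ∈ R → ι i ∈ remove i R
    ι∈remove i∈R = ∈-remove⁺ (closed i∈R) (fixpoint-free i∈R)

    ∣removePair∣ : i ∈ R → ∣ R ∣ ≡ 2 + ∣ removePair ι i R ∣
    ∣removePair∣ i∈R = trans (∣remove∣ i∈R) (cong suc (∣remove∣ (ι∈remove i∈R)))

    sum-removePair : i ∈ R → sum R ≈ (e i ∙ e (ι i)) ∙ sum (removePair ι i R)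
    sum-removePair i∈R = ≈-trans (sumSub-remove e i∈R)
      (≈-trans (∙-congˡ (sumSub-remove e (ι∈remove i∈R))) (≈-sym (assoc _ _ _)))

    removePair-PairedBy : ∀ i → PairedBy ι (removePair ι i R)
    removePair-PairedBy i = record
      { involutive    = involutive
      ; closed        = closed′
      ; fixpoint-free = λ h → fixpoint-free (proj₁ (∈-removePair⁻ ι h))
      }
      where
      closed′ : ∀ {j} → j ∈ removePair ι i R → ι j ∈ removePair ι i R
      closed′ {j} h =
        let j∈R , j≢i , j≢ιi = ∈-removePair⁻ ι h
        in ∈-remove⁺ (∈-remove⁺ (closed j∈R) (λ ιj≡i → j≢ιi (trans (sym (involutive j)) (cong ι ιj≡i))))
                     (λ ιj≡ιi → j≢i (trans (sym (involutive j)) (trans (cong ι ιj≡ιi) (involutive i))))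

  PairsSumTo : (Fin order → Fin order) → Carrier → Subset order → Set ℓ
  PairsSumTo ι w R = ∀ {i} → i ∈ R → e i ∙ e (ι i) ≈ w

  neg-pairs : ∀ R → PairsSumTo neg ε R
  neg-pairs R {i} _ = ≈-trans (∙-congˡ (e-neg i)) (inverseʳ (e i))

  sum-PairedBy : ∀ {ι w} R → PairedBy ι R → PairsSumTo ι w R → ∃ λ k → k + k ≡ ∣ R ∣ × sum R ≈ k · w
  sum-PairedBy {ι} {w} R = go ∣ R ∣ R refl
    where
    go : ∀ n R → ∣ R ∣ ≡ n → PairedBy ι R → PairsSumTo ι w R → ∃ λ k → k + k ≡ ∣ R ∣ × sum R ≈ k · w
    go zero    R ∣R∣≡0   _ _ = 0 , sym ∣R∣≡0 , sumSub-∣∣≡0 e R ∣R∣≡0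
    go (suc n) R ∣R∣≡1+n π pairs = step n (suc-injective (trans (sym ∣R∣≡2+∣R′∣) ∣R∣≡1+n))
      where
      x = proj₁ (∣p∣>0⇒nonempty R (subst (0 <_) (sym ∣R∣≡1+n) (s≤s z≤n)))
      x∈R : x ∈ R
      x∈R = proj₂ (∣p∣>0⇒nonempty R (subst (0 <_) (sym ∣R∣≡1+n) (s≤s z≤n)))
      R′ = removePair ι x R
      ∣R∣≡2+∣R′∣ : ∣ R ∣ ≡ 2 + ∣ R′ ∣
      ∣R∣≡2+∣R′∣ = ∣removePair∣ π x∈R
      step : ∀ n′ → suc ∣ R′ ∣ ≡ n′ → ∃ λ k → k + k ≡ ∣ R ∣ × sum R ≈ k · w
      step zero    ()
      step (suc n′) ∣R′∣≡n′ =
        let k , k+k≡∣R′∣ , sumR′ = go n′ R′ (suc-injective ∣R′∣≡n′) (removePair-PairedBy π x)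
                                      (pairs ∘ proj₁ ∘ ∈-removePair⁻ ι)
        in suc k
         , trans (cong suc (+-suc k k)) (trans (cong (2 +_) k+k≡∣R′∣) (sym ∣R∣≡2+∣R′∣))
         , ≈-trans (sum-removePair π x∈R) (∙-cong (pairs x∈R) sumR′)

  Disjoint : Subset order → Subset order → Set
  Disjoint R C = ∀ {i} → i ∈ R → i ∉ C

  extend-by-pairs : ∀ {ι w} k C R → PairedBy ι R → PairsSumTo ι w R → Disjoint R C → k + k ≤ ∣ R ∣ →
    ∃ λ C′ → C ⊆ C′ × ∣ C′ ∣ ≡ (k + k) + ∣ C ∣ × sum C′ ≈ k · w ∙ sum C
  extend-by-pairs zero    C R _ _ _ _ = C , id , refl , ≈-sym (identityˡ _)
  extend-by-pairs {ι} {w} (suc k) C R π pairs R∩C=∅ 2+2k≤∣R∣ =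
    let C′ , C₁⊆C′ , ∣C′∣ , sumC′ = extend-by-pairs k C₁ R′ (removePair-PairedBy π x)
                                      (pairs ∘ proj₁ ∘ ∈-removePair⁻ ι) R′∩C₁=∅ 2k≤∣R′∣
    in C′ , C₁⊆C′ ∘ ∈-insert⁺ ∘ ∈-insert⁺
     , trans ∣C′∣ (trans (cong (k + k +_) ∣C₁∣) (sym (shift k ∣ C ∣)))
     , (begin
         sum C′                          ≈⟨ sumC′ ⟩
         k · w ∙ sum C₁                  ≈⟨ ∙-congˡ sumC₁ ⟩
         k · w ∙ (w ∙ sum C)             ≈⟨ assoc _ _ _ ⟨
         (k · w ∙ w) ∙ sum C             ≈⟨ ∙-congʳ (comm _ _) ⟩
         suc k · w ∙ sum C               ∎)
    where
    open PairedBy π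
    x = proj₁ (∣p∣>0⇒nonempty R (≤-trans (s≤s z≤n) 2+2k≤∣R∣))
    x∈R : x ∈ R
    x∈R = proj₂ (∣p∣>0⇒nonempty R (≤-trans (s≤s z≤n) 2+2k≤∣R∣))
    C₁ = insert x (insert (ι x) C)
    R′ = removePair ι x R
    ιx∉C : ι x ∉ C
    ιx∉C = R∩C=∅ (closed x∈R)
    x∉ιx∷C : x ∉ insert (ι x) C
    x∉ιx∷C = ∉-insert (fixpoint-free x∈R ∘ sym) (R∩C=∅ x∈R)
    ∣C₁∣ : ∣ C₁ ∣ ≡ 2 + ∣ C ∣
    ∣C₁∣ = trans (∣insert∣ x∉ιx∷C) (cong suc (∣insert∣ ιx∉C))
    sumC₁ : sum C₁ ≈ w ∙ sum C
    sumC₁ = begin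
      sum C₁                          ≈⟨ sumSub-insert e x∉ιx∷C ⟩
      e x ∙ sum (insert (ι x) C)      ≈⟨ ∙-congˡ (sumSub-insert e ιx∉C) ⟩
      e x ∙ (e (ι x) ∙ sum C)         ≈⟨ assoc _ _ _ ⟨
      (e x ∙ e (ι x)) ∙ sum C         ≈⟨ ∙-congʳ (pairs x∈R) ⟩
      w ∙ sum C                       ∎
    R′∩C₁=∅ : Disjoint R′ C₁
    R′∩C₁=∅ h = let j∈R , j≢x , j≢ιx = ∈-removePair⁻ ι h in ∉-insert j≢x (∉-insert j≢ιx (R∩C=∅ j∈R))
    2k≤∣R′∣ : k + k ≤ ∣ R′ ∣
    2k≤∣R′∣ = ≤-pred (≤-pred (subst₂ _≤_ (cong suc (+-suc k k)) (∣removePair∣ π x∈R) 2+2k≤∣R∣))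

  avoid : ∀ {ι} D R → PairedBy ι R →
    ∃ λ R′ → R′ ⊆ R × PairedBy ι R′ × Disjoint R′ D × ∣ R ∣ ≤ (∣ D ∣ + ∣ D ∣) + ∣ R′ ∣
  avoid {ι} D R π = go ∣ D ∣ D R refl π
    where
    go : ∀ n D R → ∣ D ∣ ≡ n → PairedBy ι R →
         ∃ λ R′ → R′ ⊆ R × PairedBy ι R′ × Disjoint R′ D × ∣ R ∣ ≤ (n + n) + ∣ R′ ∣
    go zero    D R ∣D∣≡0   π = R , id , π , (λ _ → ∣p∣≡0⇒∉ ∣D∣≡0) , ≤-refl
    go (suc n) D R ∣D∣≡1+n π =
      let R′ , R′⊆R₁ , π′ , R′∩D′=∅ , ∣R₁∣≤ = go n D′ R₁ ∣D′∣≡n (removePair-PairedBy π y)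
      in R′ , proj₁ ∘ ∈-removePair⁻ ι ∘ R′⊆R₁ , π′
       , (λ x∈R′ x∈D → R′∩D′=∅ x∈R′ (∈-remove⁺ x∈D (proj₁ (proj₂ (∈-removePair⁻ ι (R′⊆R₁ x∈R′))))))
       , ≤-trans (∣removePair∣-≤ ι y R) (subst (2 + ∣ R₁ ∣ ≤_) (sym (regroup n _)) (+-monoʳ-≤ 2 ∣R₁∣≤))
      where
      y = proj₁ (∣p∣>0⇒nonempty D (subst (0 <_) (sym ∣D∣≡1+n) (s≤s z≤n)))
      y∈D : y ∈ D
      y∈D = proj₂ (∣p∣>0⇒nonempty D (subst (0 <_) (sym ∣D∣≡1+n) (s≤s z≤n)))
      D′ = remove y D
      R₁ = removePair ι y R
      ∣D′∣≡n : ∣ D′ ∣ ≡ n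
      ∣D′∣≡n = suc-injective (trans (sym (∣remove∣ y∈D)) ∣D∣≡1+n)
      regroup : ∀ n r → suc n + suc n + r ≡ 2 + (n + n + r)
      regroup = solve-∀

  0∈_^_ : ℕ → Subset order → Set ℓ
  0∈ h ^ A = ZeroInRestrictedSumset G h A

  0∈^-mono : ∀ {h} → q ⊆ p → 0∈ h ^ q → 0∈ h ^ p
  0∈^-mono q⊆p (B , B⊆q , ∣B∣ , sumB) = B , q⊆p ∘ B⊆q , ∣B∣ , sumB

  0∈^-remove : ∀ {h A} → ∣ A ∣ ≡ suc h → i ∈ A → e i ≈ sum A → 0∈ h ^ A
  0∈^-remove {i = i} {h} {A} ∣A∣≡1+h i∈A i≈sumA =
    remove i A , proj₁ ∘ ∈-remove⁻ , suc-injective (trans (sym (∣remove∣ i∈A)) ∣A∣≡1+h) ,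
    identityʳ-unique (e i) _ (≈-trans (≈-sym (sumSub-remove e i∈A)) (≈-sym i≈sumA))

  0∈^-remove₂ : ∀ {h A} → ∣ A ∣ ≡ 2 + h → i ∈ A → i′ ∈ A → i′ ≢ i → e i ∙ e i′ ≈ sum A →
                0∈ h ^ A
  0∈^-remove₂ {i = i} {i′} {h} {A} ∣A∣≡2+h i∈A i′∈A i′≢i ii′≈sumA =
    let B , B⊆A-i , ∣B∣≡h , sumB≈ε = 0∈^-remove ∣A-i∣≡1+h (∈-remove⁺ i′∈A i′≢i) i′≈sumA-i
    in B , proj₁ ∘ ∈-remove⁻ ∘ B⊆A-i , ∣B∣≡h , sumB≈ε
    where
    ∣A-i∣≡1+h : ∣ remove i A ∣ ≡ suc h
    ∣A-i∣≡1+h = suc-injective (trans (sym (∣remove∣ i∈A)) ∣A∣≡2+h)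
    i′≈sumA-i : e i′ ≈ sum (remove i A)
    i′≈sumA-i = ∙-cancelˡ (e i) _ _ (≈-trans ii′≈sumA (sumSub-remove e i∈A))

  0∉^-of-size : ∀ {h A} → ∣ A ∣ ≡ h → ¬ sum A ≈ ε → ¬ 0∈ h ^ A
  0∉^-of-size ∣A∣≡h sumA≉ε (B , B⊆A , ∣B∣≡h , sumB≈ε) =
    sumA≉ε (≈-trans (reflexive (cong sum (sym (⊆∧∣∣≡⇒≡ B⊆A (trans ∣B∣≡h (sym ∣A∣≡h)))))) sumB≈ε)

  0∉^⇒∣∣≤ : ∀ {h} k → (∀ A → ∣ A ∣ ≡ suc k → 0∈ h ^ A) → ∀ A → ¬ 0∈ h ^ A → ∣ A ∣ ≤ k
  0∉^⇒∣∣≤ k large⇒0∈ A 0∉A with ∣ A ∣ ≤? k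
  ... | yes ∣A∣≤k = ∣A∣≤k
  ... | no  ∣A∣≰k =
    let A′ , A′⊆A , ∣A′∣ = ⊆-ofSize (suc k) A (≰⇒> ∣A∣≰k)
    in ⊥-elim (0∉A (0∈^-mono A′⊆A (large⇒0∈ A′ ∣A′∣)))

  sumList : List (Fin order) → Carrier
  sumList = foldr (λ i t → e i ∙ t) ε

  sum-fromList : ∀ {xs} → Unique xs → sum (fromList xs) ≈ sumList xs
  sum-fromList {[]}     []              = sumSub-∣∣≡0 e ⊥ (∣⊥∣≡0 order)
  sum-fromList {_ ∷ _}  (x≢xs ∷ unique) = ≈-trans (sumSub-insert e (∉-fromList x≢xs)) (∙-congˡ (sum-fromList unique))

  -- The complement A of a witness set has sum A ≈ e pivot ∉ A, so 0 ∉ h^A when ∣ A ∣ ≡ h + 1.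
  record Witness (k : ℕ) : Set (c ⊔ ℓ) where
    field
      set      : Subset order
      pivot    : Fin order
      size     : ∣ set ∣ ≡ k
      pivot∈   : pivot ∈ set
      balanced : e pivot ∙ sum set ≈ sumG

  witness⇒0∉^ : ∀ {k h} → Witness k → k + suc h ≡ order → Σ (Subset order) λ A → ∣ A ∣ ≡ suc h × ¬ 0∈ h ^ A
  witness⇒0∉^ {k} {h} W k+1+h≡n = ∁ C , ∣∁C∣≡1+h , 0∉∁C
    where
    open Witness W renaming (set to C)
    ∣∁C∣≡1+h : ∣ ∁ C ∣ ≡ suc h
    ∣∁C∣≡1+h = +-cancelˡ-≡ k _ _
      (trans (subst (λ t → t + ∣ ∁ C ∣ ≡ order) size (∣p∣+∣∁p∣≡n C)) (sym k+1+h≡n))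
    0∉∁C : ¬ 0∈ h ^ ∁ C
    0∉∁C (B , B⊆∁C , ∣B∣≡h , sumB≈ε) =
      let a , a∈∁C , B≡∁C-a = ⊆∧1+∣∣≡⇒≡remove B⊆∁C (trans (cong suc ∣B∣≡h) (sym ∣∁C∣≡1+h))
          sum∁C≈a : sum (∁ C) ≈ e a
          sum∁C≈a = begin
            sum (∁ C)                   ≈⟨ sumSub-remove e a∈∁C ⟩
            e a ∙ sum (remove a (∁ C))  ≡⟨ cong (λ B → e a ∙ sum B) B≡∁C-a ⟨
            e a ∙ sum B                 ≈⟨ ∙-congˡ sumB≈ε ⟩
            e a ∙ ε                     ≈⟨ identityʳ _ ⟩
            e a                         ∎
          pivot≈sum∁C : e pivot ≈ sum (∁ C)
          pivot≈sum∁C = ∙-cancelʳ (sum C) _ _ (begin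
            e pivot ∙ sum C             ≈⟨ balanced ⟩
            sumG                        ≈⟨ sumSub-⊤ e C ⟩
            sum C ∙ sum (∁ C)           ≈⟨ comm _ _ ⟩
            sum (∁ C) ∙ sum C           ∎)
      in x∈∁p⇒x∉p a∈∁C (subst (_∈ C) (e-injective (≈-trans pivot≈sum∁C sum∁C≈a)) pivot∈)

  witness-fromList : ∀ c xs → Unique (c ∷ xs) → e c ∙ sumList (c ∷ xs) ≈ sumG → Witness (length (c ∷ xs))
  witness-fromList c xs unique balanced = record
    { set      = fromList (c ∷ xs)
    ; pivot    = c
    ; size     = ∣fromList∣ unique
    ; pivot∈   = x∈insert c (fromList xs)
    ; balanced = ≈-trans (∙-congˡ (sum-fromList unique)) balanced
    }

  annihilator? : ∀ k → (∀ x → k · x ≈ ε) ⊎ ∃ λ i → ¬ k · e i ≈ ε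
  annihilator? k with any? (λ i → ¬? (k · e i ≈? ε))
  ... | yes counterexample = inj₂ counterexample
  ... | no  none           = inj₁ λ x → begin
    k · x           ≈⟨ ×-congʳ k (e-index x) ⟨
    k · e (index x) ≈⟨ decidable-stable (k · e (index x) ≈? ε) (λ ≉ε → none (index x , ≉ε)) ⟩
    ε               ∎

  ∃-nonzero-sum-of-size : ∀ h → 0 < h → h < order → ∃ λ A → ∣ A ∣ ≡ h × ¬ sum A ≈ ε
  ∃-nonzero-sum-of-size h 0<h h<n with ⊆-ofSize h ⊤ (subst (h ≤_) (sym (∣⊤∣≡n order)) (≤-trans (n≤1+n h) h<n))
  ... | A₀ , _ , ∣A₀∣≡h with sum A₀ ≈? ε
  ...   | no  sumA₀≉ε = A₀ , ∣A₀∣≡h , sumA₀≉ε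
  ...   | yes sumA₀≈ε
    with ∣p∣>0⇒nonempty A₀ (subst (0 <_) (sym ∣A₀∣≡h) 0<h)
       | ∣p∣>0⇒nonempty (∁ A₀)
           (m<n∧m+k≡n⇒0<k h<n (trans (cong (_+ ∣ ∁ A₀ ∣) (sym ∣A₀∣≡h)) (∣p∣+∣∁p∣≡n A₀)))
  ...   | a , a∈A₀ | b , b∈∁A₀ = insert b (remove a A₀) , ∣A∣≡h , sumA≉ε
    where
    b∉A₀ : b ∉ A₀
    b∉A₀ = x∈∁p⇒x∉p b∈∁A₀
    b∉A₀-a : b ∉ remove a A₀
    b∉A₀-a = b∉A₀ ∘ proj₁ ∘ ∈-remove⁻
    ∣A∣≡h : ∣ insert b (remove a A₀) ∣ ≡ h
    ∣A∣≡h = trans (∣insert∣ b∉A₀-a) (trans (sym (∣remove∣ a∈A₀)) ∣A₀∣≡h)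
    sumA≉ε : ¬ sum (insert b (remove a A₀)) ≈ ε
    sumA≉ε sumA≈ε = b∉A₀ (subst (_∈ A₀) (e-injective (∙-cancelʳ (sum (remove a A₀)) _ _ (begin
      e a ∙ sum (remove a A₀)      ≈⟨ sumSub-remove e a∈A₀ ⟨
      sum A₀                       ≈⟨ sumA₀≈ε ⟩
      ε                            ≈⟨ sumA≈ε ⟨
      sum (insert b (remove a A₀)) ≈⟨ sumSub-insert e b∉A₀-a ⟩
      e b ∙ sum (remove a A₀)      ∎))) a∈A₀)

  3-torsion⇒contains-own-sum : (∀ x → 3 · x ≈ ε) → sumG ≈ ε → ∀ A → ∣ ∁ A ∣ ≡ 2 → index (sum A) ∈ A
  3-torsion⇒contains-own-sum 3·x≈ε sumG≈ε A ∣∁A∣≡2 with index (sum A) ∈? A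
  ... | yes k∈A = k∈A
  ... | no  k∉A with ∃-∈-avoiding (∁ A) (index (sum A) ∷ []) (subst (1 <_) (sym ∣∁A∣≡2) (s≤s (s≤s z≤n)))
  ...   | y , y∈∁A , y≢k ∷ [] = ⊥-elim (y≢k (e-injective (∙-cancelˡ (e k) _ _ (∙-cancelˡ (e k) _ _ (begin
    e k ∙ (e k ∙ e y)          ≈⟨ ∙-cong (e-index _) (∙-congˡ (≈-sym (sum-∣∣≡1 y∈∁A-k ∣∁A-k∣≡1))) ⟩
    sum A ∙ (e k ∙ sum (∁A-k)) ≈⟨ ∙-congˡ (sumSub-remove e k∈∁A) ⟨
    sum A ∙ sum (∁ A)          ≈⟨ sumSub-⊤ e A ⟨
    sumG                       ≈⟨ sumG≈ε ⟩
    ε                          ≈⟨ 3·x≈ε (e k) ⟨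
    3 · e k                    ≈⟨ 3·x≈x∙xx (e k) ⟩
    e k ∙ (e k ∙ e k)          ∎)))))
    where
    k = index (sum A)
    k∈∁A : k ∈ ∁ A
    k∈∁A = x∉p⇒x∈∁p k∉A
    ∁A-k = remove k (∁ A)
    y∈∁A-k : y ∈ ∁A-k
    y∈∁A-k = ∈-remove⁺ y∈∁A y≢k
    ∣∁A-k∣≡1 : ∣ ∁A-k ∣ ≡ 1
    ∣∁A-k∣≡1 = suc-injective (trans (sym (∣remove∣ k∈∁A)) ∣∁A∣≡2)

  module Exponent {q} (exponent : IsExponent G q) where

    q·x≈ε : ∀ x → q · x ≈ ε
    q·x≈ε x = ≈-trans (reflexive (sym (·≡Defs· q x))) (proj₁ (proj₂ exponent) x)

    q≤annihilator : ∀ k → 0 < k → (∀ x → k · x ≈ ε) → q ≤ k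
    q≤annihilator k 0<k k·x≈ε = proj₂ (proj₂ exponent) k 0<k (λ x → ≈-trans (reflexive (·≡Defs· k x)) (k·x≈ε x))

    q≡3 : ¬ IsElementary2Group G → (∀ x → 3 · x ≈ ε) → q ≡ 3
    q≡3 non-elementary 3·x≈ε = by-value q refl (q≤annihilator 3 (s≤s z≤n) 3·x≈ε)
      where
      by-value : ∀ k → q ≡ k → k ≤ 3 → k ≡ 3
      by-value 0 q≡0 _ = ⊥-elim (<-irrefl (sym q≡0) (proj₁ exponent))
      by-value 1 q≡1 _ = ⊥-elim (non-elementary λ x → begin
        x ∙ x     ≈⟨ ∙-cong x≈ε x≈ε ⟩
        ε ∙ ε     ≈⟨ identityˡ ε ⟩
        ε         ∎)
        where
        x≈ε : ∀ {x} → x ≈ ε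
        x≈ε {x} = ≈-trans (≈-sym (identityʳ x)) (subst (λ k → k · x ≈ ε) q≡1 (q·x≈ε x))
      by-value 2 q≡2 _ = ⊥-elim (non-elementary λ x →
        ≈-trans (∙-congˡ (≈-sym (identityʳ x))) (subst (λ k → k · x ≈ ε) q≡2 (q·x≈ε x)))
      by-value 3 _ _ = refl
      by-value (suc (suc (suc (suc _)))) _ (s≤s (s≤s (s≤s ())))

  module TwoTorsion (T : Subset order) (T-spec : ∀ i → (i ∈ T) ⇔ (e i ∙ e i ≈ ε)) where

    ∈T⇒x²≈ε : i ∈ T → e i ∙ e i ≈ ε
    ∈T⇒x²≈ε {i} = Equivalence.to (T-spec i)

    x²≈ε⇒∈T : e i ∙ e i ≈ ε → i ∈ T
    x²≈ε⇒∈T {i} = Equivalence.from (T-spec i)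

    index∈T : ∀ {x} → x ∙ x ≈ ε → index x ∈ T
    index∈T x²≈ε = x²≈ε⇒∈T (≈-trans (∙-cong (e-index _) (e-index _)) x²≈ε)

    εᵢ∈T : εᵢ ∈ T
    εᵢ∈T = index∈T (identityˡ ε)

    P : Subset order
    P = ∁ T

    P-pairedBy-neg : PairedBy neg P
    P-pairedBy-neg = record
      { involutive    = neg-involutive
      ; closed        = λ {i} i∈P → x∉p⇒x∈∁p (x∈∁p⇒x∉p i∈P ∘ x²≈ε⇒∈T ∘ square-neg i ∘ ∈T⇒x²≈ε)
      ; fixpoint-free = λ {i} i∈P negi≡i → x∈∁p⇒x∉p i∈P (x²≈ε⇒∈T (begin
          e i ∙ e i        ≡⟨ cong (λ j → e i ∙ e j) negi≡i ⟨
          e i ∙ e (neg i)  ≈⟨ neg-pairs P i∈P ⟩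
          ε                ∎))
      }
      where
      square-neg : ∀ i → e (neg i) ∙ e (neg i) ≈ ε → e i ∙ e i ≈ ε
      square-neg i sq = ⁻¹-injective (begin
        (e i ∙ e i) ⁻¹            ≈⟨ ⁻¹-∙-comm (e i) (e i) ⟨
        e i ⁻¹ ∙ e i ⁻¹           ≈⟨ ∙-cong (e-neg i) (e-neg i) ⟨
        e (neg i) ∙ e (neg i)     ≈⟨ sq ⟩
        ε                         ≈⟨ ε⁻¹≈ε ⟨
        ε ⁻¹                      ∎)

    sumG≈sumT : sumG ≈ sum T
    sumG≈sumT = begin
      sumG              ≈⟨ sumSub-⊤ e T ⟩
      sum T ∙ sum P     ≈⟨ ∙-congˡ sumP≈ε ⟩
      sum T ∙ ε         ≈⟨ identityʳ _ ⟩
      sum T             ∎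
      where
      sumP≈ε : sum P ≈ ε
      sumP≈ε = let k , _ , sumP≈k·ε = sum-PairedBy P P-pairedBy-neg (neg-pairs P)
               in ≈-trans sumP≈k·ε (·-ε k)

    translate : Fin order → Fin order → Fin order
    translate u i = index (e i ∙ e u)

    module _ {u} (u∈T : u ∈ T) (u≢εᵢ : u ≢ εᵢ) where

      T-pairedBy-translate : PairedBy (translate u) T
      T-pairedBy-translate = record
        { involutive    = λ i → sym (index-unique (begin
            e i                       ≈⟨ identityʳ _ ⟨
            e i ∙ ε                   ≈⟨ ∙-congˡ (∈T⇒x²≈ε u∈T) ⟨
            e i ∙ (e u ∙ e u)         ≈⟨ assoc _ _ _ ⟨
            (e i ∙ e u) ∙ e u         ≈⟨ ∙-congʳ (e-index _) ⟨
            e (translate u i) ∙ e u   ∎))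
        ; closed        = λ i∈T → index∈T (square-∙ (∈T⇒x²≈ε i∈T) (∈T⇒x²≈ε u∈T))
        ; fixpoint-free = λ {i} _ τi≡i → ≢εᵢ⇒≉ε u≢εᵢ
            (identityʳ-unique (e i) (e u) (index-≡⇒≈ τi≡i))
        }

      translate-pairs : PairsSumTo (translate u) (e u) T
      translate-pairs {i} i∈T = begin
        e i ∙ e (translate u i)   ≈⟨ ∙-congˡ (e-index _) ⟩
        e i ∙ (e i ∙ e u)         ≈⟨ assoc _ _ _ ⟨
        (e i ∙ e i) ∙ e u         ≈⟨ ∙-congʳ (∈T⇒x²≈ε i∈T) ⟩
        ε ∙ e u                   ≈⟨ identityˡ _ ⟩
        e u                       ∎

      sumT≈half·u : sum T ≈ ⌊ ∣ T ∣ /2⌋ · e u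
      sumT≈half·u =
        let k , k+k≡∣T∣ , sumT≈k·u = sum-PairedBy T T-pairedBy-translate translate-pairs
        in ≈-trans sumT≈k·u (reflexive (cong (_· e u) (trans (n≡⌊n+n/2⌋ k) (cong ⌊_/2⌋ k+k≡∣T∣))))

    sumT-∣T∣≡1 : ∣ T ∣ ≡ 1 → sum T ≈ ε
    sumT-∣T∣≡1 ∣T∣≡1 = ≈-trans (sum-∣∣≡1 εᵢ∈T ∣T∣≡1) e-εᵢ

    sumT-3≤∣T∣ : 3 ≤ ∣ T ∣ → sum T ≈ ε
    sumT-3≤∣T∣ 3≤∣T∣ with ∃-∈-avoiding T (εᵢ ∷ []) (≤-trans (s≤s (s≤s z≤n)) 3≤∣T∣)
    ... | u , u∈T , u≢εᵢ ∷ [] with ∃-∈-avoiding T (εᵢ ∷ u ∷ []) 3≤∣T∣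
    ... | v , v∈T , v≢εᵢ ∷ v≢u ∷ [] = identityʳ-unique (sum T) (sum T) (begin
      sum T ∙ sum T         ≈⟨ ∙-cong (sumT≈half·u u∈T u≢εᵢ) (sumT≈half·u v∈T v≢εᵢ) ⟩
      h · e u ∙ h · e v     ≈⟨ ×-distrib-+ (e u) (e v) h ⟨
      h · (e u ∙ e v)       ≈⟨ ×-congʳ h (e-index _) ⟨
      h · e w               ≈⟨ sumT≈half·u w∈T w≢εᵢ ⟨
      sum T                 ∎)
      where
      h = ⌊ ∣ T ∣ /2⌋
      w = index (e u ∙ e v)
      w∈T : w ∈ T
      w∈T = index∈T (square-∙ (∈T⇒x²≈ε u∈T) (∈T⇒x²≈ε v∈T))
      w≢εᵢ : w ≢ εᵢ
      w≢εᵢ w≡εᵢ = v≢u (e-injective (begin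
        e v        ≈⟨ inverseʳ-unique (e u) (e v) (≈-trans (index-≡⇒≈ w≡εᵢ) e-εᵢ) ⟩
        e u ⁻¹     ≈⟨ inverseʳ-unique (e u) (e u) (∈T⇒x²≈ε u∈T) ⟨
        e u        ∎))

    ∣T∣≢2⇒sumG≈ε : ∣ T ∣ ≢ 2 → sumG ≈ ε
    ∣T∣≢2⇒sumG≈ε ∣T∣≢2 = ≈-trans sumG≈sumT (by-size ∣ T ∣ refl ∣T∣≢2)
      where
      by-size : ∀ n → ∣ T ∣ ≡ n → n ≢ 2 → sum T ≈ ε
      by-size 0                   ∣T∣≡0 _   = ⊥-elim (∣p∣≡0⇒∉ ∣T∣≡0 εᵢ∈T)
      by-size 1                   ∣T∣≡1 _   = sumT-∣T∣≡1 ∣T∣≡1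
      by-size 2                   _     2≢2 = ⊥-elim (2≢2 refl)
      by-size (suc (suc (suc n))) ∣T∣≡n _   = sumT-3≤∣T∣ (subst (3 ≤_) (sym ∣T∣≡n) (s≤s (s≤s (s≤s z≤n))))

    extend : ∀ {d} → Witness d → ∀ k → (k + k + d) + (k + k + d) ≤ ∣ P ∣ → Witness (k + k + d)
    extend {d} W k bound with avoid (Witness.set W) P P-pairedBy-neg
    ... | R , _ , π , R∩C=∅ , ∣P∣≤2d+∣R∣ = record
      { set      = C′
      ; pivot    = pivot
      ; size     = trans ∣C′∣ (cong (k + k +_) size)
      ; pivot∈   = C⊆C′ pivot∈
      ; balanced = begin
          e pivot ∙ sum C′          ≈⟨ ∙-congˡ sumC′ ⟩
          e pivot ∙ (k · ε ∙ sum C) ≈⟨ ∙-congˡ (≈-trans (∙-congʳ (·-ε k)) (identityˡ _)) ⟩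
          e pivot ∙ sum C           ≈⟨ balanced ⟩
          sumG                      ∎
      }
      where
      open Witness W renaming (set to C)
      extension = extend-by-pairs k C R π (neg-pairs R) R∩C=∅
        (2[2k+d]≤p≤2d+r⇒2k≤r k d bound (subst (λ t → ∣ P ∣ ≤ (t + t) + ∣ R ∣) size ∣P∣≤2d+∣R∣))
      C′ = proj₁ extension
      C⊆C′ : C ⊆ C′
      C⊆C′ = proj₁ (proj₂ extension)
      ∣C′∣ : ∣ C′ ∣ ≡ k + k + ∣ C ∣
      ∣C′∣ = proj₁ (proj₂ (proj₂ extension))
      sumC′ : sum C′ ≈ k · ε ∙ sum C
      sumC′ = proj₂ (proj₂ (proj₂ extension))

    reflect : Carrier → Fin order → Fin order
    reflect t i = index (t ∙ e i ⁻¹)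

    reflect-sum : ∀ t i → e i ∙ e (reflect t i) ≈ t
    reflect-sum t i = begin
      e i ∙ e (reflect t i)   ≈⟨ ∙-congˡ (e-index _) ⟩
      e i ∙ (t ∙ e i ⁻¹)      ≈⟨ x∙yz≈y∙xz _ _ _ ⟩
      t ∙ (e i ∙ e i ⁻¹)      ≈⟨ ∙-congˡ (inverseʳ _) ⟩
      t ∙ ε                   ≈⟨ identityʳ _ ⟩
      t                       ∎

    ∣fixed∣≤∣T∣ : ∀ t A → ∣ filter (λ i → reflect t i Fin.≟ i) A ∣ ≤ ∣ T ∣
    ∣fixed∣≤∣T∣ t A with ∣ filter (λ i → reflect t i Fin.≟ i) A ∣ in ∣F∣≡
    ... | zero  = z≤n
    ... | suc _ = subst (_≤ ∣ T ∣) ∣F∣≡ (injection⇒∣p∣≤∣q∣ (λ i → index (e i ∙ e i₀ ⁻¹)) maps injective)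
      where
      fixed? = λ i → reflect t i Fin.≟ i
      F = filter fixed? A
      square≈t : ∀ {i} → i ∈ F → e i ∙ e i ≈ t
      square≈t {i} i∈F = begin
        e i ∙ e i                 ≡⟨ cong (λ r → e i ∙ e r) (proj₂ (∈-filter⁻ {p = A} fixed? i∈F)) ⟨
        e i ∙ e (reflect t i)     ≈⟨ reflect-sum t i ⟩
        t                         ∎
      i₀-props = ∣p∣>0⇒nonempty F (subst (0 <_) (sym ∣F∣≡) (s≤s z≤n))
      i₀ = proj₁ i₀-props
      maps : ∀ {i} → i ∈ F → index (e i ∙ e i₀ ⁻¹) ∈ T
      maps i∈F = index∈T (square-quotient (square≈t i∈F) (square≈t (proj₂ i₀-props)))
      injective : ∀ {i i′} → i ∈ F → i′ ∈ F →
                  index (e i ∙ e i₀ ⁻¹) ≡ index (e i′ ∙ e i₀ ⁻¹) → i ≡ i′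
      injective _ _ eq = e-injective (∙-cancelʳ (e i₀ ⁻¹) _ _
        (≈-trans (≈-sym (e-index _)) (≈-trans (reflexive (cong e eq)) (e-index _))))

    ∣A∣+∣A∣≤n+∣T∣ : ∀ t A → (∀ {i} → i ∈ A → reflect t i ∈ A → reflect t i ≡ i) →
                    ∣ A ∣ + ∣ A ∣ ≤ order + ∣ T ∣
    ∣A∣+∣A∣≤n+∣T∣ t A no-pair = subst (λ n → ∣ A ∣ + ∣ A ∣ ≤ n + ∣ T ∣) (∣p∣+∣∁p∣≡n A)
      (a≤t+c⇒a+a≤[a+c]+t (subst (_≤ ∣ T ∣ + ∣ ∁ A ∣) (∣filter∣+∣filter¬∣ fixed? A)
        (+-mono-≤ (∣fixed∣≤∣T∣ t A) (injection⇒∣p∣≤∣q∣ (reflect t) maps injective))))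
      where
      fixed? = λ i → reflect t i Fin.≟ i
      maps : ∀ {i} → i ∈ filter (¬? ∘ fixed?) A → reflect t i ∈ ∁ A
      maps i∈NF = let i∈A , not-fixed = ∈-filter⁻ (¬? ∘ fixed?) i∈NF
                  in x∉p⇒x∈∁p (not-fixed ∘ no-pair i∈A)
      injective : ∀ {i i′} → _ → _ → reflect t i ≡ reflect t i′ → i ≡ i′
      injective {i} {i′} _ _ eq = e-injective (∙-cancelʳ (e (reflect t i)) _ _ (begin
        e i ∙ e (reflect t i)     ≈⟨ reflect-sum t i ⟩
        t                         ≈⟨ reflect-sum t i′ ⟨
        e i′ ∙ e (reflect t i′)   ≡⟨ cong (λ r → e i′ ∙ e r) eq ⟨
        e i′ ∙ e (reflect t i)    ∎))

    ∃-pair-summing-to : ∀ t A → order + ∣ T ∣ < ∣ A ∣ + ∣ A ∣ →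
      ∃ λ i → ∃ λ i′ → i ∈ A × i′ ∈ A × i′ ≢ i × e i ∙ e i′ ≈ t
    ∃-pair-summing-to t A n+∣T∣<2∣A∣
      with any? (λ i → i ∈? A ×-dec reflect t i ∈? A ×-dec ¬? (reflect t i Fin.≟ i))
    ... | yes (i , i∈A , r∈A , r≢i) = i , reflect t i , i∈A , r∈A , r≢i , reflect-sum t i
    ... | no no-pair = ⊥-elim (<⇒≱ n+∣T∣<2∣A∣ (∣A∣+∣A∣≤n+∣T∣ t A λ {i} i∈A r∈A →
            decidable-stable (reflect t i Fin.≟ i) (λ r≢i → no-pair (i , i∈A , r∈A , r≢i))))

    Z-upper : ∀ h → order + ∣ T ∣ ≤ 2 * (h + 1) → ∀ A → ¬ 0∈ h ^ A → ∣ A ∣ ≤ suc h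
    Z-upper h n+∣T∣≤2[h+1] = 0∉^⇒∣∣≤ (suc h) λ A ∣A∣≡2+h →
      let i , i′ , i∈A , i′∈A , i′≢i , ii′≈sumA =
            ∃-pair-summing-to (sum A) A (subst (λ a → order + ∣ T ∣ < a + a) (sym ∣A∣≡2+h)
                                              (m≤2[h+1]⇒m<[2+h]+[2+h] n+∣T∣≤2[h+1]))
      in 0∈^-remove₂ ∣A∣≡2+h i∈A i′∈A i′≢i ii′≈sumA

    ∈P⇒≢εᵢ : i ∈ P → i ≢ εᵢ
    ∈P⇒≢εᵢ i∈P i≡εᵢ = x∈∁p⇒x∉p i∈P (subst (_∈ T) (sym i≡εᵢ) εᵢ∈T)

    module _ (sumG≈ε : sumG ≈ ε) where

      witness₁ : Witness 1
      witness₁ = witness-fromList εᵢ [] ([] ∷ [])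
        (≈-trans (∙-congˡ (identityʳ _)) (≈-trans (∈T⇒x²≈ε εᵢ∈T) (≈-sym sumG≈ε)))

      witness₂ : ∀ c → ¬ 3 · e c ≈ ε → Witness 2
      witness₂ c 3c≉ε = witness-fromList c (d ∷ []) ((c≢d ∷ []) ∷ [] ∷ []) (begin
        e c ∙ (e c ∙ (e d ∙ ε))      ≈⟨ ∙-congˡ (∙-congˡ (identityʳ _)) ⟩
        e c ∙ (e c ∙ e d)            ≈⟨ assoc _ _ _ ⟨
        (e c ∙ e c) ∙ e d            ≈⟨ ∙-congˡ (e-index _) ⟩
        (e c ∙ e c) ∙ (e c ∙ e c) ⁻¹ ≈⟨ inverseʳ _ ⟩
        ε                            ≈⟨ sumG≈ε ⟨
        sumG                         ∎)
        where
        d = index ((e c ∙ e c) ⁻¹)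
        c≢d : c ≢ d
        c≢d c≡d = 3c≉ε (begin
          3 · e c                      ≈⟨ 3·x≈x∙xx (e c) ⟩
          e c ∙ (e c ∙ e c)            ≈⟨ comm _ _ ⟩
          (e c ∙ e c) ∙ e c            ≈⟨ ∙-congˡ (index-≡⇒≈ (sym c≡d)) ⟨
          (e c ∙ e c) ∙ (e c ∙ e c) ⁻¹ ≈⟨ inverseʳ _ ⟩
          ε                            ∎)

      witness₄ : (∀ x → 3 · x ≈ ε) → 3 ≤ ∣ P ∣ → Witness 4
      witness₄ 3·x≈ε 3≤∣P∣ with ∃-∈-avoiding P [] (≤-trans (s≤s z≤n) 3≤∣P∣)
      ... | a , a∈P , [] with ∃-∈-avoiding P (a ∷ neg a ∷ []) 3≤∣P∣
      ... | b , b∈P , b≢a ∷ b≢-a ∷ [] =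
        witness-fromList w (εᵢ ∷ a ∷ b ∷ [])
          ( (w≢εᵢ ∷ w≢a ∷ w≢b ∷ [])
          ∷ ((∈P⇒≢εᵢ a∈P ∘ sym) ∷ (∈P⇒≢εᵢ b∈P ∘ sym) ∷ [])
          ∷ ((b≢a ∘ sym) ∷ [])
          ∷ [] ∷ [])
          (begin
            e w ∙ (e w ∙ (e εᵢ ∙ (e a ∙ (e b ∙ ε)))) ≈⟨ ∙-congˡ (∙-congˡ ε∙ab≈w) ⟩
            e w ∙ (e w ∙ e w)                        ≈⟨ 3·x≈x∙xx (e w) ⟨
            3 · e w                                  ≈⟨ 3·x≈ε (e w) ⟩
            ε                                        ≈⟨ sumG≈ε ⟨
            sumG                                     ∎)
        where
        w = index (e a ∙ e b)
        ε∙ab≈w : e εᵢ ∙ (e a ∙ (e b ∙ ε)) ≈ e w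
        ε∙ab≈w = begin
          e εᵢ ∙ (e a ∙ (e b ∙ ε))   ≈⟨ ∙-cong e-εᵢ (∙-congˡ (identityʳ _)) ⟩
          ε ∙ (e a ∙ e b)            ≈⟨ identityˡ _ ⟩
          e a ∙ e b                  ≈⟨ e-index _ ⟨
          e w                        ∎
        w≢εᵢ : w ≢ εᵢ
        w≢εᵢ w≡εᵢ = b≢-a (index-unique (inverseʳ-unique (e a) (e b) (≈-trans (index-≡⇒≈ w≡εᵢ) e-εᵢ)))
        w≢a : w ≢ a
        w≢a w≡a = ∈P⇒≢εᵢ b∈P (index-unique (identityʳ-unique (e a) (e b) (index-≡⇒≈ w≡a)))
        w≢b : w ≢ b
        w≢b w≡b = ∈P⇒≢εᵢ a∈P (index-unique (identityˡ-unique (e a) (e b) (index-≡⇒≈ w≡b)))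

    module UniqueInvolution (∣T∣≡2 : ∣ T ∣ ≡ 2) where

      private
        j-props = ∃-∈-avoiding T (εᵢ ∷ []) (subst (1 <_) (sym ∣T∣≡2) (s≤s (s≤s z≤n)))

      j : Fin order
      j = proj₁ j-props

      j∈T : j ∈ T
      j∈T = proj₁ (proj₂ j-props)

      j≢εᵢ : j ≢ εᵢ
      j≢εᵢ = All.head (proj₂ (proj₂ j-props))

      private
        j∈T-εᵢ : j ∈ remove εᵢ T
        j∈T-εᵢ = ∈-remove⁺ j∈T j≢εᵢ

        ∣T-εᵢ∣≡1 : ∣ remove εᵢ T ∣ ≡ 1
        ∣T-εᵢ∣≡1 = suc-injective (trans (sym (∣remove∣ εᵢ∈T)) ∣T∣≡2)

      ∈T⇒εᵢ⊎j : i ∈ T → i ≡ εᵢ ⊎ i ≡ j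
      ∈T⇒εᵢ⊎j {i} i∈T with i Fin.≟ εᵢ | i Fin.≟ j
      ... | yes i≡εᵢ | _       = inj₁ i≡εᵢ
      ... | no _     | yes i≡j = inj₂ i≡j
      ... | no i≢εᵢ  | no i≢j  = ⊥-elim (∣p∣≡0⇒∉
              (suc-injective (trans (sym (∣remove∣ j∈T-εᵢ)) ∣T-εᵢ∣≡1))
              (∈-remove⁺ (∈-remove⁺ i∈T i≢εᵢ) i≢j))

      sumG≈j : sumG ≈ e j
      sumG≈j = begin
        sumG                       ≈⟨ sumG≈sumT ⟩
        sum T                      ≈⟨ sumSub-remove e εᵢ∈T ⟩
        e εᵢ ∙ sum (remove εᵢ T)   ≈⟨ ∙-cong e-εᵢ (sum-∣∣≡1 j∈T-εᵢ ∣T-εᵢ∣≡1) ⟩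
        ε ∙ e j                    ≈⟨ identityˡ _ ⟩
        e j                        ∎

      j≉ε : ¬ e j ≈ ε
      j≉ε = ≢εᵢ⇒≉ε j≢εᵢ

      3·j≈j : 3 · e j ≈ e j
      3·j≈j = begin
        3 · e j                ≈⟨ 3·x≈x∙xx (e j) ⟩
        e j ∙ (e j ∙ e j)      ≈⟨ ∙-congˡ (∈T⇒x²≈ε j∈T) ⟩
        e j ∙ ε                ≈⟨ identityʳ _ ⟩
        e j                    ∎

      witness₀ⱼ : Witness 2
      witness₀ⱼ = witness-fromList εᵢ (j ∷ []) (((j≢εᵢ ∘ sym) ∷ []) ∷ [] ∷ []) (begin
        e εᵢ ∙ (e εᵢ ∙ (e j ∙ ε))    ≈⟨ ∙-cong e-εᵢ (∙-cong e-εᵢ (identityʳ _)) ⟩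
        ε ∙ (ε ∙ e j)                ≈⟨ ≈-trans (identityˡ _) (identityˡ _) ⟩
        e j                          ≈⟨ sumG≈j ⟨
        sumG                         ∎)

      witness-√j : ∀ {c} → e c ∙ e c ≈ e j → Witness 1
      witness-√j {c} c²≈j = witness-fromList c [] ([] ∷ [])
        (≈-trans (∙-congˡ (identityʳ _)) (≈-trans c²≈j (≈-sym sumG≈j)))

      witness₃ : ∀ {x} → x ∈ P → ¬ e x ∙ e x ≈ e j → Witness 3
      witness₃ {x} x∈P x²≉j = witness-fromList εᵢ (x ∷ y ∷ [])
          (((∈P⇒≢εᵢ x∈P ∘ sym) ∷ (y≢εᵢ ∘ sym) ∷ []) ∷ (x≢y ∷ []) ∷ [] ∷ [])
          (begin
            e εᵢ ∙ (e εᵢ ∙ (e x ∙ (e y ∙ ε))) ≈⟨ ∙-cong e-εᵢ (∙-cong e-εᵢ (∙-congˡ (identityʳ _))) ⟩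
            ε ∙ (ε ∙ (e x ∙ e y))            ≈⟨ ≈-trans (identityˡ _) (identityˡ _) ⟩
            e x ∙ e y                        ≈⟨ reflect-sum (e j) x ⟩
            e j                              ≈⟨ sumG≈j ⟨
            sumG                             ∎)
        where
        y = reflect (e j) x
        x≢y : x ≢ y
        x≢y x≡y = x²≉j (≈-trans (∙-congˡ (reflexive (cong e x≡y))) (reflect-sum (e j) x))
        y≢εᵢ : y ≢ εᵢ
        y≢εᵢ y≡εᵢ = x∈∁p⇒x∉p x∈P (x²≈ε⇒∈T (≈-trans (∙-cong x≈j x≈j) (∈T⇒x²≈ε j∈T)))
          where
          x≈j : e x ≈ e j
          x≈j = begin
            e x          ≈⟨ identityʳ _ ⟨
            e x ∙ ε      ≈⟨ ∙-congˡ (≈-trans (reflexive (cong e y≡εᵢ)) e-εᵢ) ⟨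
            e x ∙ e y    ≈⟨ reflect-sum (e j) x ⟩
            e j          ∎

      -- If 2x₀ = j then any x ∉ {x₀, x₀ + j} works: 2x = j would put x − x₀ in T = {0, j}.
      ∃-non-root : 3 ≤ ∣ P ∣ → ∃ λ x → x ∈ P × ¬ e x ∙ e x ≈ e j
      ∃-non-root 3≤∣P∣ with ∃-∈-avoiding P [] (≤-trans (s≤s z≤n) 3≤∣P∣)
      ... | x₀ , x₀∈P , [] with e x₀ ∙ e x₀ ≈? e j
      ...   | no  x₀²≉j = x₀ , x₀∈P , x₀²≉j
      ...   | yes x₀²≈j with ∃-∈-avoiding P (x₀ ∷ index (e x₀ ∙ e j) ∷ []) 3≤∣P∣
      ...     | x , x∈P , x≢x₀ ∷ x≢x₀+j ∷ [] = x , x∈P , x²≉j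
        where
        x²≉j : ¬ e x ∙ e x ≈ e j
        x²≉j x²≈j with ∈T⇒εᵢ⊎j (index∈T (square-quotient x²≈j x₀²≈j))
        ... | inj₁ d≡εᵢ = x≢x₀ (e-injective (x∙y⁻¹≈ε⇒x≈y _ _ (≈-trans (index-≡⇒≈ d≡εᵢ) e-εᵢ)))
        ... | inj₂ d≡j  = x≢x₀+j (index-unique (begin
          e x                  ≈⟨ x≈z//y (e x) (e x₀ ⁻¹) (e j) (index-≡⇒≈ d≡j) ⟩
          e j ∙ e x₀ ⁻¹ ⁻¹     ≈⟨ ∙-congˡ (⁻¹-involutive (e x₀)) ⟩
          e j ∙ e x₀           ≈⟨ comm _ _ ⟩
          e x₀ ∙ e j           ∎))

      module _ {q} (exponent : IsExponent G q) where
        open Exponent exponent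

        residue·j≈ε : (q % 4) · e j ≈ ε
        residue·j≈ε = ≈-trans (≈-sym (·-mod q 4 (e j) (4·x≈ε (∈T⇒x²≈ε j∈T) (identityˡ ε)))) (q·x≈ε (e j))

        -- By minimality of q some x has 2r · x ≠ 0; then r · x squares to an element of T ∖ {0}.
        ∃-√j-of-4∣q : ∀ r → q ≡ r * 4 → ∃ λ c → e c ∙ e c ≈ e j
        ∃-√j-of-4∣q zero    q≡0 = ⊥-elim (<-irrefl (sym q≡0) (proj₁ exponent))
        ∃-√j-of-4∣q (suc r) q≡4r with annihilator? (suc r + suc r)
        ... | inj₁ 2r·x≈ε = ⊥-elim (<⇒≱ (subst (suc r + suc r <_) ([r+r]+[r+r]≡r*4 (suc r)) (m<m+n _ (s≤s z≤n)))
                                        (subst (_≤ suc r + suc r) q≡4r (q≤annihilator _ (s≤s z≤n) 2r·x≈ε)))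
        ... | inj₂ (i , 2r·i≉ε) = index (suc r · e i) , (begin
              e root ∙ e root                   ≈⟨ ∙-cong (e-index _) (e-index _) ⟩
              suc r · e i ∙ suc r · e i         ≈⟨ ×-homo-+ (e i) (suc r) (suc r) ⟨
              (suc r + suc r) · e i             ≈⟨ e-index _ ⟨
              e y                               ≈⟨ reflexive (cong e y≡j) ⟩
              e j                               ∎)
          where
          root = index (suc r · e i)
          y = index ((suc r + suc r) · e i)
          y∈T : y ∈ T
          y∈T = index∈T (begin
            (suc r + suc r) · e i ∙ (suc r + suc r) · e i   ≈⟨ ×-homo-+ (e i) (suc r + suc r) (suc r + suc r) ⟨
            ((suc r + suc r) + (suc r + suc r)) · e i       ≡⟨ cong (_· e i) (trans ([r+r]+[r+r]≡r*4 (suc r)) (sym q≡4r)) ⟩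
            q · e i                                         ≈⟨ q·x≈ε (e i) ⟩
            ε                                               ∎)
          y≡j : y ≡ j
          y≡j with ∈T⇒εᵢ⊎j y∈T
          ... | inj₁ y≡εᵢ = ⊥-elim (2r·i≉ε (≈-trans (index-≡⇒≈ y≡εᵢ) e-εᵢ))
          ... | inj₂ y≡j  = y≡j

        ∃-√j : q % 4 ≢ 2 → ∃ λ c → e c ∙ e c ≈ e j
        ∃-√j q%4≢2 = by-residue (q % 4) refl q%4≢2
          where
          ρ·j≈ε : ∀ {ρ} → q % 4 ≡ ρ → ρ · e j ≈ ε
          ρ·j≈ε q%4≡ρ = subst (λ ρ → ρ · e j ≈ ε) q%4≡ρ residue·j≈ε
          by-residue : ∀ ρ → q % 4 ≡ ρ → ρ ≢ 2 → ∃ λ c → e c ∙ e c ≈ e j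
          by-residue 0 q%4≡0 _ = ∃-√j-of-4∣q (q / 4) (trans (m≡m%n+[m/n]*n q 4) (cong (_+ q / 4 * 4) q%4≡0))
          by-residue 1 q%4≡1 _ = ⊥-elim (j≉ε (≈-trans (≈-sym (identityʳ _)) (ρ·j≈ε q%4≡1)))
          by-residue 2 _ 2≢2 = ⊥-elim (2≢2 refl)
          by-residue 3 q%4≡3 _ = ⊥-elim (j≉ε (≈-trans (≈-sym 3·j≈j) (ρ·j≈ε q%4≡3)))
          by-residue (suc (suc (suc (suc ρ)))) q%4≡4+ρ _ =
            ⊥-elim (<⇒≱ (m%n<n q 4) (subst (4 ≤_) (sym q%4≡4+ρ) (s≤s (s≤s (s≤s (s≤s z≤n))))))

        q≡2mod4⇒contains-own-sum : q % 4 ≡ 2 → ∀ A → ∣ ∁ A ∣ ≡ 1 → index (sum A) ∈ A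
        q≡2mod4⇒contains-own-sum q%4≡2 A ∣∁A∣≡1 with index (sum A) ∈? A
        ... | yes k∈A = k∈A
        ... | no  k∉A = ⊥-elim (j≉ε (begin
          e j              ≈⟨ k²≈j ⟨
          e k ∙ e k        ≈⟨ 2·x≈x∙x (e k) ⟨
          2 · e k          ≡⟨ cong (_· e k) q%4≡2 ⟨
          (q % 4) · e k    ≈⟨ ·-mod q 4 (e k) (4·x≈ε k²≈j (∈T⇒x²≈ε j∈T)) ⟨
          q · e k          ≈⟨ q·x≈ε (e k) ⟩
          ε                ∎))
          where
          k = index (sum A)
          k²≈j : e k ∙ e k ≈ e j
          k²≈j = begin
            e k ∙ e k          ≈⟨ ∙-cong (e-index _) (≈-sym (sum-∣∣≡1 (x∉p⇒x∈∁p k∉A) ∣∁A∣≡1)) ⟩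
            sum A ∙ sum (∁ A)  ≈⟨ sumSub-⊤ e A ⟨
            sumG               ≈⟨ sumG≈j ⟩
            e j                ∎

  module Main (non-elementary : ¬ IsElementary2Group G) {q l} (exponent : IsExponent G q)
              (two-torsion : IsOrderOfTwoTorsion G l) {h} (n+l≤2[h+1] : order + l ≤ 2 * (h + 1))
              (h+2≤n : h + 2 ≤ order) where

    T : Subset order
    T = proj₁ two-torsion

    ∣T∣≡l : ∣ T ∣ ≡ l
    ∣T∣≡l = proj₂ (proj₂ two-torsion)

    open TwoTorsion T (proj₁ (proj₂ two-torsion))
    open Exponent exponent

    Exceptional : Set
    Exceptional = ((h + 3 ≡ order) × (q ≡ 3)) ⊎ ((h + 2 ≡ order) × (l ≡ 2) × (q % 4 ≡ 2))

    1+h≤n : suc h ≤ order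
    1+h≤n = ≤-trans (n≤1+n _) (subst (_≤ order) (+-comm h 2) h+2≤n)

    m : ℕ
    m = proj₁ (m≤n⇒∃[o]m+o≡n 1+h≤n)

    m+1+h≡n : m + suc h ≡ order
    m+1+h≡n = trans (+-comm m (suc h)) (proj₂ (m≤n⇒∃[o]m+o≡n 1+h≤n))

    m+m≤∣P∣ : m + m ≤ ∣ P ∣
    m+m≤∣P∣ = m+1+h≡n⇒m+m≤p m+1+h≡n n+l≤2[h+1]
                (subst (λ t → t + ∣ P ∣ ≡ order) ∣T∣≡l (∣p∣+∣∁p∣≡n T))

    ≤m⇒≤∣P∣ : ∀ {d} → d ≤ m → d ≤ ∣ P ∣
    ≤m⇒≤∣P∣ d≤m = ≤-trans d≤m (≤-trans (m≤m+n m m) m+m≤∣P∣)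

    extend-to-m : ∀ {d} → Witness d → ∀ k → m ≡ k + k + d → Witness m
    extend-to-m W k m≡2k+d = subst Witness (sym m≡2k+d) (extend W k (subst (λ t → t + t ≤ ∣ P ∣) m≡2k+d m+m≤∣P∣))

    witness-sumG≈ε : sumG ≈ ε → ¬ Exceptional → ∀ k → m ≡ k + k + 1 ⊎ m ≡ k + k + 2 → Witness m
    witness-sumG≈ε sumG≈ε _ k (inj₁ m≡2k+1) = extend-to-m (witness₁ sumG≈ε) k m≡2k+1
    witness-sumG≈ε sumG≈ε ¬exc k (inj₂ m≡2k+2) with annihilator? 3
    ... | inj₂ (c , 3c≉ε) = extend-to-m (witness₂ sumG≈ε c 3c≉ε) k m≡2k+2
    ... | inj₁ 3·x≈ε      = of-3-torsion k m≡2k+2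
      where
      of-3-torsion : ∀ k → m ≡ k + k + 2 → Witness m
      of-3-torsion zero    m≡2      = ⊥-elim (¬exc (inj₁ (h+3≡n , q≡3 non-elementary 3·x≈ε)))
        where
        h+3≡n : h + 3 ≡ order
        h+3≡n = trans (+-comm h 3) (subst (λ t → t + suc h ≡ order) m≡2 m+1+h≡n)
      of-3-torsion (suc k) m≡2k+4 =
        extend-to-m (witness₄ sumG≈ε 3·x≈ε (≤m⇒≤∣P∣ 3≤m)) k (trans m≡2k+4 (shift k 2))
        where
        3≤m : 3 ≤ m
        3≤m = subst (3 ≤_) (sym (trans m≡2k+4 (shift k 2))) (≤-trans (n≤1+n 3) (m≤n+m 4 (k + k)))

    witness-∣T∣≡2 : ∣ T ∣ ≡ 2 → ¬ Exceptional → ∀ k → m ≡ k + k + 1 ⊎ m ≡ k + k + 2 → Witness m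
    witness-∣T∣≡2 ∣T∣≡2 _ k (inj₂ m≡2k+2) = extend-to-m witness₀ⱼ k m≡2k+2
      where open UniqueInvolution ∣T∣≡2
    witness-∣T∣≡2 ∣T∣≡2 ¬exc zero (inj₁ m≡1) =
      subst Witness (sym m≡1) (witness-√j (proj₂ (∃-√j exponent q%4≢2)))
      where
      open UniqueInvolution ∣T∣≡2
      h+2≡n : h + 2 ≡ order
      h+2≡n = trans (+-comm h 2) (subst (λ t → t + suc h ≡ order) m≡1 m+1+h≡n)
      q%4≢2 : q % 4 ≢ 2
      q%4≢2 q%4≡2 = ¬exc (inj₂ (h+2≡n , trans (sym ∣T∣≡l) ∣T∣≡2 , q%4≡2))
    witness-∣T∣≡2 ∣T∣≡2 _ (suc k) (inj₁ m≡2k+3)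
      with UniqueInvolution.∃-non-root ∣T∣≡2
             (≤m⇒≤∣P∣ (subst (3 ≤_) (sym (trans m≡2k+3 (shift k 1))) (m≤n+m 3 (k + k))))
    ... | x , x∈P , x²≉j = extend-to-m (witness₃ x∈P x²≉j) k (trans m≡2k+3 (shift k 1))
      where open UniqueInvolution ∣T∣≡2

    witness : ¬ Exceptional → Witness m
    witness ¬exc with ∣ T ∣ ≟ 2 | parity⁺ m (m+1+h≡n⇒0<m m+1+h≡n h+2≤n)
    ... | yes ∣T∣≡2 | k , shape = witness-∣T∣≡2 ∣T∣≡2 ¬exc k shape
    ... | no  ∣T∣≢2 | k , shape = witness-sumG≈ε (∣T∣≢2⇒sumG≈ε ∣T∣≢2) ¬exc k shape

    Z-lower-exceptional : Σ (Subset order) λ A → ∣ A ∣ ≡ h × ¬ 0∈ h ^ A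
    Z-lower-exceptional =
      let A , ∣A∣≡h , sumA≉ε = ∃-nonzero-sum-of-size h 0<h 1+h≤n
      in A , ∣A∣≡h , 0∉^-of-size ∣A∣≡h sumA≉ε
      where
      0<h : 0 < h
      0<h = n+l≤2[h+1]⇒0<h n+l≤2[h+1] (subst (0 <_) ∣T∣≡l (subst (0 <_) (sym (∣remove∣ εᵢ∈T)) (s≤s z≤n))) h+2≤n

    ∣∁A∣≡ : ∀ A {d} → ∣ A ∣ ≡ suc h → h + suc d ≡ order → ∣ ∁ A ∣ ≡ d
    ∣∁A∣≡ A {d} ∣A∣≡1+h h+1+d≡n = +-cancelˡ-≡ (suc h) _ _
      (trans (cong (_+ ∣ ∁ A ∣) (sym ∣A∣≡1+h)) (trans (∣p∣+∣∁p∣≡n A) (trans (sym h+1+d≡n) (+-suc h d))))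

    contains-own-sum : Exceptional → ∀ A → ∣ A ∣ ≡ suc h → index (sum A) ∈ A
    contains-own-sum (inj₁ (h+3≡n , q≡3)) A ∣A∣≡1+h =
      3-torsion⇒contains-own-sum 3·x≈ε (∣T∣≢2⇒sumG≈ε ∣T∣≢2) A (∣∁A∣≡ A ∣A∣≡1+h h+3≡n)
      where
      3·x≈ε : ∀ x → 3 · x ≈ ε
      3·x≈ε = subst (λ k → ∀ x → k · x ≈ ε) q≡3 q·x≈ε
      ∣T∣≢2 : ∣ T ∣ ≢ 2
      ∣T∣≢2 ∣T∣≡2 = j≉ε (≈-trans (≈-sym 3·j≈j) (3·x≈ε (e j)))
        where open UniqueInvolution ∣T∣≡2
    contains-own-sum (inj₂ (h+2≡n , l≡2 , q%4≡2)) A ∣A∣≡1+h =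
      q≡2mod4⇒contains-own-sum exponent q%4≡2 A (∣∁A∣≡ A ∣A∣≡1+h h+2≡n)
      where open UniqueInvolution (trans ∣T∣≡l l≡2)

    Z-upper-exceptional : Exceptional → ∀ A → ¬ 0∈ h ^ A → ∣ A ∣ ≤ h
    Z-upper-exceptional exc =
      0∉^⇒∣∣≤ h λ A ∣A∣≡1+h → 0∈^-remove ∣A∣≡1+h (contains-own-sum exc A ∣A∣≡1+h) (e-index _)

    Z-upper-generic : ∀ A → ¬ 0∈ h ^ A → ∣ A ∣ ≤ suc h
    Z-upper-generic = Z-upper h (subst (λ t → order + t ≤ 2 * (h + 1)) (sym ∣T∣≡l) n+l≤2[h+1])

theorem4p4 : {c ℓ : Level} (G : FiniteAbelianGroup c ℓ) →
    ¬ IsElementary2Group G →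
    (q l : ℕ) → IsExponent G q → IsOrderOfTwoTorsion G l →
    (h : ℕ) →
    FiniteAbelianGroup.order G + l ≤ 2 * (h + 1) →
    h + 2 ≤ FiniteAbelianGroup.order G →
    let n = FiniteAbelianGroup.order G
        Exc = ((h + 3 ≡ n) × (q ≡ 3)) ⊎ ((h + 2 ≡ n) × (l ≡ 2) × (q % 4 ≡ 2))
    in (Exc → IsZ G h h) × (¬ Exc → IsZ G h (suc h))
theorem4p4 G non-elementary q l exponent two-torsion h n+l≤2[h+1] h+2≤n =
    (λ exc → Z-lower-exceptional , Z-upper-exceptional exc)
  , (λ ¬exc → witness⇒0∉^ G (witness ¬exc) m+1+h≡n , Z-upper-generic)
  where open Main G non-elementary exponent two-torsion n+l≤2[h+1] h+2≤n
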